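{- Let $G$ be a planar graph with a fixed embedding and maximum degree $4$, and let $H$ be a demand graph on $V(G)$ whose edges form a matching, such that every $v$ with $\deg_H(v)=1$ has $\deg_G(v)\le3$. Let $G''$ be obtained from $G$ as follows: every vertex $v$ with $\deg_H(v)=0$ and $\deg_G(v)=4$ is replaced by a $4$-cycle $u_1u_2u_3u_4$ with the four edges formerly incident to $v$ attached to $u_1,u_2,u_3,u_4$ respectively in their clockwise order (preserving planarity); every vertex $v$ with $\deg_H(v)=1$ and $\deg_G(v)\le2$ is left unchanged; every vertex $v$ with $\deg_H(v)=1$ and $\deg_G(v)=3$ has each of its three incident edges subdivided by a new node and a triangle added on these three new nodes. Then $H$ has an integral uncrossed flow in $G$ if and only if $G''$ contains pairwise totally node-disjoint paths, one joining the ends of each edge of $H$.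
   Context: An integral uncrossed flow for $H$ in $G$ (unit capacities and demands) is a choice of one path in $G$ joining the ends of each edge of $H$ such that the paths are pairwise edge-disjoint and pairwise uncrossed: edge-disjoint paths $P,Q$ cross if at some common node $v$ that is internal to both, with $P$ using edges $e,e'$ and $Q$ using $g,g'$ at $v$, these appear clockwise around $v$ as $e,g,e',g'$ or $e,g',e',g$. Totally node-disjoint paths share no nodes, including endpoints. -}

module Defs where

open import Data.Nat using (ℕ; zero; suc; _+_; _*_; _≤_)
open import Data.Fin using (Fin; zero; suc; toℕ; inject₁; fromℕ)
open import Data.Fin.Properties using (_≟_)
open import Data.Bool using (Bool; true; false; not)
open import Data.List using (List; []; _∷_; _++_; length; map; allFin)
open import Data.Nat.ListAction using (sum)
open import Data.List.Membership.Propositional using (_∈_)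
open import Data.List.Relation.Unary.Unique.Propositional using (Unique)
import Data.List.Relation.Binary.Sublist.Propositional as SL
open import Data.Product using (Σ; ∃; _×_; _,_; proj₁; proj₂)
open import Data.Sum using (_⊎_; inj₁; inj₂)
open import Data.Empty using (⊥)
open import Function.Bundles using (_⇔_)
open import Function.Definitions using (Surjective)
open import Relation.Nullary using (¬_; Dec; yes; no)
open import Relation.Binary.PropositionalEquality using (_≡_; _≢_)
open import Relation.Binary.Construct.Closure.Equivalence using (EqClosure)

-- Embedded (loopless multi)graphs: vertices Fin n, edges Fin m,
-- the embedding is a rotation system: for each vertex v the list of
-- incident edges in clockwise order.

record EmbGraph (n m : ℕ) : Set where
  field
    src tgt      : Fin m → Fin n
    loopless     : ∀ e → src e ≢ tgt e
    rot          : Fin n → List (Fin m)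
    rot-unique   : ∀ v → Unique (rot v)
    rot-complete : ∀ v e → (e ∈ rot v) ⇔ (src e ≡ v ⊎ tgt e ≡ v)

open EmbGraph public

deg : ∀ {n m} → EmbGraph n m → Fin n → ℕ
deg G v = length (rot G v)

MaxDeg4 : ∀ {n m} → EmbGraph n m → Set
MaxDeg4 G = ∀ v → deg G v ≤ 4

Joins : ∀ {n m} → EmbGraph n m → Fin m → Fin n → Fin n → Set
Joins G e u v = (src G e ≡ u × tgt G e ≡ v) ⊎ (src G e ≡ v × tgt G e ≡ u)

-- Planarity of the rotation system (Euler's formula, genus 0).

CycSucc : ∀ {A : Set} → List A → A → A → Set
CycSucc {A} r a b =
  (Σ (List A) λ xs → Σ (List A) λ ys → r ≡ xs ++ (a ∷ b ∷ ys))
  ⊎ (Σ (List A) λ zs → r ≡ b ∷ (zs ++ (a ∷ [])))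
  ⊎ (r ≡ a ∷ [] × b ≡ a)

Dart : ℕ → Set
Dart m = Fin m × Bool

dartVertex : ∀ {n m} → EmbGraph n m → Dart m → Fin n
dartVertex G (e , false) = src G e
dartVertex G (e , true)  = tgt G e

-- face permutation φ = σ ∘ α : go to the other end of the edge, then
-- turn to the next edge in the rotation there
FaceStep : ∀ {n m} → EmbGraph n m → Dart m → Dart m → Set
FaceStep G (e , b) (e' , b') =
  CycSucc (rot G (dartVertex G (e , not b))) e e'
  × dartVertex G (e' , b') ≡ dartVertex G (e , not b)

-- face carriers: darts, plus isolated vertices (each is one face)
FaceCarrier : ∀ {n m} → EmbGraph n m → Set
FaceCarrier {n} {m} G = Dart m ⊎ Σ (Fin n) (λ v → rot G v ≡ [])

data SameFace {n m} (G : EmbGraph n m) : FaceCarrier G → FaceCarrier G → Set where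
  dartFace : ∀ {d d'} → EqClosure (FaceStep G) d d' → SameFace G (inj₁ d) (inj₁ d')
  isoFace  : ∀ {v v' p p'} → v ≡ v' → SameFace G (inj₂ (v , p)) (inj₂ (v' , p'))

AdjG : ∀ {n m} → EmbGraph n m → Fin n → Fin n → Set
AdjG {m = m} G u v = Σ (Fin m) λ e → Joins G e u v

NumClasses : (A : Set) → (A → A → Set) → ℕ → Set
NumClasses A R k =
  Σ (A → Fin k) λ f → Surjective _≡_ _≡_ f × (∀ a b → (f a ≡ f b) ⇔ R a b)

Planar : ∀ {n m} → EmbGraph n m → Set
Planar {n} {m} G = Σ ℕ λ F → Σ ℕ λ C →
  NumClasses (FaceCarrier G) (SameFace G) F
  × NumClasses (Fin n) (EqClosure (AdjG G)) C
  × n + F ≡ m + 2 * C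

record Demand (n k : ℕ) : Set where
  field
    hs ht : Fin k → Fin n

open Demand public

EndOf : ∀ {n k} → Demand n k → Fin k → Fin n → Set
EndOf H j v = v ≡ hs H j ⊎ v ≡ ht H j

IsMatching : ∀ {n k} → Demand n k → Set
IsMatching H = (∀ j → hs H j ≢ ht H j)
             × (∀ j j' v → EndOf H j v → EndOf H j' v → j ≡ j')

ind : ∀ {P : Set} → Dec P → ℕ
ind (yes _) = 1
ind (no _)  = 0

degH : ∀ {n k} → Demand n k → Fin n → ℕ
degH {k = k} H v =
  sum (map (λ j → ind (v ≟ hs H j) + ind (v ≟ ht H j)) (allFin k))

record GPath {n m} (G : EmbGraph n m) (s t : Fin n) : Set where
  field
    len    : ℕ
    vert   : Fin (suc len) → Fin n
    edge   : Fin len → Fin m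
    start  : vert zero ≡ s
    finish : vert (fromℕ len) ≡ t
    joins  : ∀ i → Joins G (edge i) (vert (inject₁ i)) (vert (suc i))
    simple : ∀ i i' → vert i ≡ vert i' → i ≡ i'

open GPath public

CycOrder : ∀ {A : Set} → List A → A → A → A → A → Set
CycOrder {A} r a b c d = Σ (List A) λ xs → Σ (List A) λ ys →
  r ≡ xs ++ ys × SL._⊆_ (a ∷ b ∷ c ∷ d ∷ []) (ys ++ xs)

Crosses : ∀ {A : Set} → List A → A → A → A → A → Set
Crosses r e e' g g' = CycOrder r e g e' g' ⊎ CycOrder r e g' e' g

Consecutive : ∀ {l} → Fin l → Fin l → Set
Consecutive a b = toℕ b ≡ suc (toℕ a)

Uncrossed : ∀ {n m} (G : EmbGraph n m) {s t s' t'} → GPath G s t → GPath G s' t' → Set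
Uncrossed G P Q =
  ∀ a b c d → Consecutive a b → Consecutive c d →
  vert P (suc a) ≡ vert Q (suc c) →
  ¬ Crosses (rot G (vert P (suc a))) (edge P a) (edge P b) (edge Q c) (edge Q d)

UncrossedFlow : ∀ {n m k} → EmbGraph n m → Demand n k → Set
UncrossedFlow {k = k} G H =
  Σ ((j : Fin k) → GPath G (hs H j) (ht H j)) λ P →
    ∀ j j' → j ≢ j' →
      (∀ a b → edge (P j) a ≢ edge (P j') b) × Uncrossed G (P j) (P j')

module _ {n m k} (G : EmbGraph n m) (H : Demand n k) where

  Rep : Fin n → Set
  Rep v = degH H v ≡ 0 × deg G v ≡ 4

  Tri : Fin n → Set
  Tri v = degH H v ≡ 1 × deg G v ≡ 3

  data Node'' : Set where
    orig : Fin n → Node''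
    cyc  : Fin n → Fin 4 → Node''
    sub  : Fin n → Fin m → Node''          -- node subdividing edge e next to v

  -- the node of G'' at which (the image of) edge e is attached at its end v
  data At (v : Fin n) (e : Fin m) : Node'' → Set where
    atCyc  : Rep v → (i : Fin (length (rot G v))) → (q : Fin 4) →
             Data.List.lookup (rot G v) i ≡ e → toℕ i ≡ toℕ q → At v e (cyc v q)
    atSub  : Tri v → e ∈ rot G v → At v e (sub v e)
    atOrig : ¬ Rep v → ¬ Tri v → At v e (orig v)

  next4 : Fin 4 → Fin 4
  next4 zero = suc zero
  next4 (suc zero) = suc (suc zero)
  next4 (suc (suc zero)) = suc (suc (suc zero))
  next4 (suc (suc (suc zero))) = zero

  data Edge'' : Node'' → Node'' → Set where
    eG     : ∀ e {x y} → At (src G e) e x → At (tgt G e) e y → Edge'' x y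
    eCyc   : ∀ {v} → Rep v → (q : Fin 4) → Edge'' (cyc v q) (cyc v (next4 q))
    eSpoke : ∀ {v e} → Tri v → e ∈ rot G v → Edge'' (orig v) (sub v e)
    eTri   : ∀ {v e e'} → Tri v → e ∈ rot G v → e' ∈ rot G v → e ≢ e' →
             Edge'' (sub v e) (sub v e')

  Adj'' : Node'' → Node'' → Set
  Adj'' x y = Edge'' x y ⊎ Edge'' y x

  record Path'' (s t : Node'') : Set where
    field
      len''    : ℕ
      vert''   : Fin (suc len'') → Node''
      start''  : vert'' zero ≡ s
      finish'' : vert'' (fromℕ len'') ≡ t
      adj''    : ∀ i → Adj'' (vert'' (inject₁ i)) (vert'' (suc i))
      simple'' : ∀ i i' → vert'' i ≡ vert'' i' → i ≡ i'

  open Path'' public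

  DisjointPaths'' : Set
  DisjointPaths'' =
    Σ ((j : Fin k) → Path'' (orig (hs H j)) (orig (ht H j))) λ P →
      ∀ j j' → j ≢ j' → ∀ a b → vert'' (P j) a ≢ vert'' (P j') b

-- Contracting every gadget of G'' back to its vertex turns the node-disjoint paths into walks
-- in G; shortcut to paths, they are edge-disjoint, since an edge used by a path has both of its
-- attachment nodes on that path. They are also uncrossed: a crossing at v needs four edges at v,
-- so v was replaced by a 4-cycle, and if e, g, e', g' alternate around v, then the cycle node at
-- which the first path's edge e is attached has both cycle neighbours (the attachments of g and
-- g') on the other path, whereas the first path passes through it and needs two distinct
-- neighbours of it, of which only one remains.
--
-- Conversely, each path of the flow is expanded by routing it through the gadgets it visits:
-- along the shorter arc of a 4-cycle, along a triangle edge, or along a spoke at an end. Two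
-- expansions could only share an original node, which degree counting excludes (four distinct
-- edges force a 4-cycle, three at an end of H force a triangle), an attachment node, which
-- edge-disjointness excludes, or the middle node of an arc between opposite positions of a
-- 4-cycle, where the other path would have to use the two remaining edges and so cross.

module Submission where

open import Data.Nat using (ℕ; zero; suc; _+_; _≤_; _<_; z≤n; s≤s)
import Data.Nat.Properties as ℕP
open import Data.Nat.ListAction using (sum)
open import Data.Fin using (Fin; zero; suc; toℕ; inject₁; fromℕ; lower₁)
import Data.Fin.Properties as FinP
open import Data.List using (List; []; _∷_; _++_; length; lookup; tabulate)
import Data.List.Properties as ListP
open import Data.List.Membership.Propositional using (_∈_; _∉_)
import Data.List.Membership.DecPropositional as DecMembership
open import Data.List.Membership.Propositional.Properties using (∈-++⁻; ∈-++⁺ˡ; ∈-++⁺ʳ; ∈-∃++)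
open import Data.List.Relation.Unary.Any using (here; there)
import Data.List.Relation.Unary.All as All
open import Data.List.Relation.Unary.All using (_∷_; [])
open import Data.List.Relation.Unary.AllPairs using (_∷_; [])
open import Data.List.Relation.Unary.Unique.Propositional using (Unique)
open import Data.List.Relation.Binary.Pointwise using (_∷_; [])
open import Data.List.Relation.Binary.Sublist.Heterogeneous using (_∷_; [])
import Data.List.Relation.Binary.Sublist.Heterogeneous.Properties as SublistP
open import Data.Maybe using (Maybe; just; nothing)
open import Data.Maybe.Properties using (just-injective)
open import Data.Product using (Σ; _×_; _,_; proj₁; proj₂)
open import Data.Sum using (_⊎_; inj₁; inj₂)
import Data.Sum
open import Data.Empty using (⊥; ⊥-elim)
open import Function using (_∘_; id)
open import Function.Bundles using (_⇔_; Equivalence; mk⇔)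
open import Relation.Nullary using (¬_; Dec; yes; no)
open import Relation.Nullary.Decidable using (_⊎-dec_; _×-dec_)
open import Relation.Binary.Definitions using (DecidableEquality)
open import Relation.Binary.Construct.Closure.ReflexiveTransitive using (Star; ε; _◅_; _◅◅_)
open import Relation.Binary.PropositionalEquality

open import Defs

module Walks {A : Set} (R : A → A → Set) where

  Walk : A → A → Set
  Walk = Star R

  steps : ∀ {x y} → Walk x y → ℕ
  steps ε = zero
  steps (_ ◅ w) = suc (steps w)

  vertices : ∀ {x y} → Walk x y → List A
  vertices {x} ε = x ∷ []
  vertices {x} (_ ◅ w) = x ∷ vertices w

  vertexAt : ∀ {x y} (w : Walk x y) → Fin (suc (steps w)) → A
  vertexAt {x} ε _ = x
  vertexAt {x} (_ ◅ w) zero = x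
  vertexAt (_ ◅ w) (suc i) = vertexAt w i

  stepAt : ∀ {x y} (w : Walk x y) (i : Fin (steps w)) → R (vertexAt w (inject₁ i)) (vertexAt w (suc i))
  stepAt (r ◅ ε) zero = r
  stepAt (r ◅ _ ◅ _) zero = r
  stepAt (_ ◅ w) (suc i) = stepAt w i

  vertexAt-zero : ∀ {x y} (w : Walk x y) → vertexAt w zero ≡ x
  vertexAt-zero ε = refl
  vertexAt-zero (_ ◅ _) = refl

  vertexAt-last : ∀ {x y} (w : Walk x y) → vertexAt w (fromℕ (steps w)) ≡ y
  vertexAt-last ε = refl
  vertexAt-last (_ ◅ w) = vertexAt-last w

  vertexAt-∈ : ∀ {x y} (w : Walk x y) i → vertexAt w i ∈ vertices w
  vertexAt-∈ ε zero = here refl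
  vertexAt-∈ (_ ◅ _) zero = here refl
  vertexAt-∈ (_ ◅ w) (suc i) = there (vertexAt-∈ w i)

  head-∈ : ∀ {x y} (w : Walk x y) → x ∈ vertices w
  head-∈ ε = here refl
  head-∈ (_ ◅ _) = here refl

  infixr 5 _◅_

  data Simple : ∀ {x y} → Walk x y → Set where
    ε  : ∀ {x} → Simple (ε {x = x})
    _◅_ : ∀ {x y z} {r : R x y} {w : Walk y z} → x ∉ vertices w → Simple w → Simple (r ◅ w)

  vertexAt-injective : ∀ {x y} {w : Walk x y} → Simple w → ∀ i j → vertexAt w i ≡ vertexAt w j → i ≡ j
  vertexAt-injective ε zero zero _ = refl
  vertexAt-injective (_ ◅ _) zero zero _ = refl
  vertexAt-injective {w = _ ◅ w} (x∉w ◅ _) zero (suc j) eq = ⊥-elim (x∉w (subst (_∈ vertices w) (sym eq) (vertexAt-∈ w j)))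
  vertexAt-injective {w = _ ◅ w} (x∉w ◅ _) (suc i) zero eq = ⊥-elim (x∉w (subst (_∈ vertices w) eq (vertexAt-∈ w i)))
  vertexAt-injective (_ ◅ s) (suc i) (suc j) eq = cong suc (vertexAt-injective s i j eq)

  fromSequence : (L : ℕ) (vert : Fin (suc L) → A) → (∀ i → R (vert (inject₁ i)) (vert (suc i))) →
                 Walk (vert zero) (vert (fromℕ L))
  fromSequence zero vert step = ε
  fromSequence (suc L) vert step = step zero ◅ fromSequence L (λ i → vert (suc i)) (λ i → step (suc i))

  fromSequence-∈ : ∀ L vert step {a} → a ∈ vertices (fromSequence L vert step) → Σ (Fin (suc L)) λ i → vert i ≡ a
  fromSequence-∈ zero vert step (here refl) = zero , refl
  fromSequence-∈ (suc L) vert step (here refl) = zero , refl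
  fromSequence-∈ (suc L) vert step (there p) with fromSequence-∈ L (λ i → vert (suc i)) (λ i → step (suc i)) p
  ... | i , eq = suc i , eq

  fromSequence-simple : ∀ L vert step → (∀ i j → vert i ≡ vert j → i ≡ j) → Simple (fromSequence L vert step)
  fromSequence-simple zero vert step inj = ε
  fromSequence-simple (suc L) vert step inj =
    head∉ ◅ fromSequence-simple L (λ i → vert (suc i)) (λ i → step (suc i)) (λ i j eq → FinP.suc-injective (inj (suc i) (suc j) eq))
    where
    head∉ : vert zero ∉ vertices (fromSequence L (λ i → vert (suc i)) (λ i → step (suc i)))
    head∉ p with fromSequence-∈ L (λ i → vert (suc i)) (λ i → step (suc i)) p
    ... | i , eq with inj (suc i) zero eq
    ... | ()

  vertices-◅◅ : ∀ {x y y' z} (w : Walk x y) (r : R y y') (w' : Walk y' z) →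
                vertices (w ◅◅ r ◅ w') ≡ vertices w ++ vertices w'
  vertices-◅◅ ε r w' = refl
  vertices-◅◅ (_ ◅ w) r w' = cong (_ ∷_) (vertices-◅◅ w r w')

  ∈-◅◅⁻ : ∀ {x y y' z} (w : Walk x y) (r : R y y') (w' : Walk y' z) {a} →
          a ∈ vertices (w ◅◅ r ◅ w') → a ∈ vertices w ⊎ a ∈ vertices w'
  ∈-◅◅⁻ w r w' p = ∈-++⁻ (vertices w) (subst (_ ∈_) (vertices-◅◅ w r w') p)

  simple-◅◅ : ∀ {x y y' z} {w : Walk x y} (r : R y y') {w' : Walk y' z} →
              Simple w → Simple w' → (∀ a → a ∈ vertices w → a ∉ vertices w') → Simple (w ◅◅ r ◅ w')
  simple-◅◅ {w = ε} r s s' disjoint = disjoint _ (here refl) ◅ s'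
  simple-◅◅ {x} {w = _ ◅ w} r {w'} (x∉w ◅ s) s' disjoint =
    x∉ ◅ simple-◅◅ r s s' (λ a p → disjoint a (there p))
    where
    x∉ : x ∉ vertices (w ◅◅ r ◅ w')
    x∉ p with ∈-◅◅⁻ w r w' p
    ... | inj₁ q = x∉w q
    ... | inj₂ q = disjoint x (here refl) q

  inner-neighbours : ∀ {x z} {w : Walk x z} → Simple w → ∀ {a} → a ∈ vertices w → a ≢ x → a ≢ z →
                     Σ A λ b → Σ A λ c → R b a × R a c × b ≢ c × b ∈ vertices w × c ∈ vertices w
  inner-neighbours {w = ε} _ (here refl) a≢x a≢z = ⊥-elim (a≢x refl)
  inner-neighbours {w = _ ◅ _} _ (here refl) a≢x a≢z = ⊥-elim (a≢x refl)
  inner-neighbours {w = _ ◅ ε} _ (there (here refl)) a≢x a≢z = ⊥-elim (a≢z refl)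
  inner-neighbours {x} {w = r ◅ r' ◅ w} (x∉ ◅ _) (there (here refl)) a≢x a≢z =
    x , _ , r , r' , (λ eq → x∉ (there (subst (_∈ vertices w) (sym eq) (head-∈ w)))) , here refl , there (there (head-∈ w))
  inner-neighbours {w = _ ◅ _ ◅ w} (_ ◅ s@(y∉ ◅ _)) (there (there p)) a≢x a≢z
    with inner-neighbours s (there p) (λ eq → y∉ (subst (_∈ vertices w) eq p)) a≢z
  ... | b , c , rb , rc , b≢c , b∈ , c∈ = b , c , rb , rc , b≢c , there b∈ , there c∈

  data AllSteps (P : ∀ {a b} → R a b → Set) : ∀ {x y} → Walk x y → Set where
    ε   : ∀ {x} → AllSteps P (ε {x = x})
    _◅_ : ∀ {x y z} {r : R x y} {w : Walk y z} → P r → AllSteps P w → AllSteps P (r ◅ w)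

  stepAt-All : ∀ {P : ∀ {a b} → R a b → Set} {x y} {w : Walk x y} → AllSteps P w → ∀ i → P (stepAt w i)
  stepAt-All {w = _ ◅ ε} (p ◅ _) zero = p
  stepAt-All {w = _ ◅ _ ◅ _} (p ◅ _) zero = p
  stepAt-All {w = _ ◅ _ ◅ _} (_ ◅ ps) (suc i) = stepAt-All ps i

  module Shortcut (_≟_ : DecidableEquality A) where

    open DecMembership _≟_ using (_∈?_)

    dropTo : ∀ {x y z} (w : Walk y z) → x ∈ vertices w → Walk x z
    dropTo ε (here refl) = ε
    dropTo (r ◅ w) (here refl) = r ◅ w
    dropTo (_ ◅ w) (there p) = dropTo w p

    dropTo-simple : ∀ {x y z} {w : Walk y z} (p : x ∈ vertices w) → Simple w → Simple (dropTo w p)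
    dropTo-simple {w = ε} (here refl) s = s
    dropTo-simple {w = _ ◅ _} (here refl) s = s
    dropTo-simple {w = _ ◅ _} (there p) (_ ◅ s) = dropTo-simple p s

    dropTo-All : ∀ {P : ∀ {a b} → R a b → Set} {x y z} {w : Walk y z} (p : x ∈ vertices w) → AllSteps P w → AllSteps P (dropTo w p)
    dropTo-All {w = ε} (here refl) ps = ps
    dropTo-All {w = _ ◅ _} (here refl) ps = ps
    dropTo-All {w = _ ◅ _} (there p) (_ ◅ ps) = dropTo-All p ps

    shortcut : ∀ {x y} → Walk x y → Walk x y
    shortcut ε = ε
    shortcut {x} (r ◅ w) with x ∈? vertices (shortcut w)
    ... | yes p = dropTo (shortcut w) p
    ... | no _ = r ◅ shortcut w

    shortcut-simple : ∀ {x y} (w : Walk x y) → Simple (shortcut w)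
    shortcut-simple ε = ε
    shortcut-simple {x} (r ◅ w) with x ∈? vertices (shortcut w)
    ... | yes p = dropTo-simple p (shortcut-simple w)
    ... | no x∉ = x∉ ◅ shortcut-simple w

    shortcut-All : ∀ {P : ∀ {a b} → R a b → Set} {x y} {w : Walk x y} → AllSteps P w → AllSteps P (shortcut w)
    shortcut-All {w = ε} ps = ps
    shortcut-All {x = x} {w = r ◅ w} (p ◅ ps) with x ∈? vertices (shortcut w)
    ... | yes q = dropTo-All q (shortcut-All ps)
    ... | no _ = p ◅ shortcut-All ps

module _ {A : Set} where

  nth : List A → ℕ → Maybe A
  nth [] _ = nothing
  nth (x ∷ xs) zero = just x
  nth (x ∷ xs) (suc i) = nth xs i

  nth-lookup : (xs : List A) (i : Fin (length xs)) → nth xs (toℕ i) ≡ just (lookup xs i)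
  nth-lookup (x ∷ xs) zero = refl
  nth-lookup (x ∷ xs) (suc i) = nth-lookup xs i

  nth-∈ : ∀ (xs : List A) i {a} → nth xs i ≡ just a → a ∈ xs
  nth-∈ (x ∷ xs) zero refl = here refl
  nth-∈ (x ∷ xs) (suc i) eq = there (nth-∈ xs i eq)

  nth-< : ∀ (xs : List A) i {a} → nth xs i ≡ just a → i < length xs
  nth-< (x ∷ xs) zero _ = s≤s z≤n
  nth-< (x ∷ xs) (suc i) eq = s≤s (nth-< xs i eq)

  nth⇒lookup : ∀ (xs : List A) i {a} → nth xs i ≡ just a → Σ (Fin (length xs)) λ f → toℕ f ≡ i × lookup xs f ≡ a
  nth⇒lookup (x ∷ xs) zero refl = zero , refl , refl
  nth⇒lookup (x ∷ xs) (suc i) eq with nth⇒lookup xs i eq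
  ... | f , toℕf≡i , lookup≡a = suc f , cong suc toℕf≡i , lookup≡a

  nth-injective : ∀ {xs : List A} → Unique xs → ∀ i j {a} → nth xs i ≡ just a → nth xs j ≡ just a → i ≡ j
  nth-injective {x ∷ xs} _ zero zero _ _ = refl
  nth-injective {x ∷ xs} (x∉ ∷ _) zero (suc j) refl q = ⊥-elim (All.lookup x∉ (nth-∈ xs j q) refl)
  nth-injective {x ∷ xs} (x∉ ∷ _) (suc i) zero p refl = ⊥-elim (All.lookup x∉ (nth-∈ xs i p) refl)
  nth-injective {x ∷ xs} (_ ∷ u) (suc i) (suc j) p q = cong suc (nth-injective u i j p q)

  unique⊆⇒length≤ : ∀ {xs ys : List A} → Unique xs → (∀ {a} → a ∈ xs → a ∈ ys) → length xs ≤ length ys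
  unique⊆⇒length≤ {[]} _ _ = z≤n
  unique⊆⇒length≤ {x ∷ xs} {ys} (x∉ ∷ u) xs⊆ys with ∈-∃++ (xs⊆ys (here refl))
  ... | ys₁ , ys₂ , refl = ℕP.≤-trans (s≤s (unique⊆⇒length≤ u xs⊆ys₁ys₂)) (ℕP.≤-reflexive length-ys)
    where
    xs⊆ys₁ys₂ : ∀ {a} → a ∈ xs → a ∈ ys₁ ++ ys₂
    xs⊆ys₁ys₂ {a} p with ∈-++⁻ ys₁ (xs⊆ys (there p))
    ... | inj₁ q = ∈-++⁺ˡ q
    ... | inj₂ (here refl) = ⊥-elim (All.lookup x∉ p refl)
    ... | inj₂ (there q) = ∈-++⁺ʳ ys₁ q
    length-ys : suc (length (ys₁ ++ ys₂)) ≡ length (ys₁ ++ x ∷ ys₂)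
    length-ys = begin
      suc (length (ys₁ ++ ys₂))         ≡⟨ cong suc (ListP.length-++ ys₁) ⟩
      suc (length ys₁ + length ys₂)     ≡⟨ ℕP.+-suc (length ys₁) (length ys₂) ⟨
      length ys₁ + length (x ∷ ys₂)     ≡⟨ ListP.length-++ ys₁ ⟨
      length (ys₁ ++ x ∷ ys₂)           ∎
      where open ≡-Reasoning

module FirstIndex {A : Set} (_≟_ : DecidableEquality A) where

  firstIndex : A → List A → ℕ
  firstIndex a [] = zero
  firstIndex a (x ∷ xs) with a ≟ x
  ... | yes _ = zero
  ... | no _ = suc (firstIndex a xs)

  nth-firstIndex : ∀ {a} (xs : List A) → a ∈ xs → nth xs (firstIndex a xs) ≡ just a
  nth-firstIndex {a} (x ∷ xs) p with a ≟ x
  ... | yes refl = refl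
  nth-firstIndex (x ∷ xs) (here eq) | no a≢x = ⊥-elim (a≢x eq)
  nth-firstIndex (x ∷ xs) (there p) | no _ = nth-firstIndex xs p

suc₄ : Fin 4 → Fin 4
suc₄ zero = suc zero
suc₄ (suc zero) = suc (suc zero)
suc₄ (suc (suc zero)) = suc (suc (suc zero))
suc₄ (suc (suc (suc zero))) = zero

pred₄ : Fin 4 → Fin 4
pred₄ zero = suc (suc (suc zero))
pred₄ (suc zero) = zero
pred₄ (suc (suc zero)) = suc zero
pred₄ (suc (suc (suc zero))) = suc (suc zero)

neighbour₄ : ∀ p r → r ≢ p → r ≢ suc₄ (suc₄ p) → r ≡ suc₄ p ⊎ r ≡ pred₄ p
neighbour₄ zero zero r≢p _ = ⊥-elim (r≢p refl)
neighbour₄ zero (suc zero) _ _ = inj₁ refl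
neighbour₄ zero (suc (suc zero)) _ r≢opp = ⊥-elim (r≢opp refl)
neighbour₄ zero (suc (suc (suc zero))) _ _ = inj₂ refl
neighbour₄ (suc zero) zero _ _ = inj₂ refl
neighbour₄ (suc zero) (suc zero) r≢p _ = ⊥-elim (r≢p refl)
neighbour₄ (suc zero) (suc (suc zero)) _ _ = inj₁ refl
neighbour₄ (suc zero) (suc (suc (suc zero))) _ r≢opp = ⊥-elim (r≢opp refl)
neighbour₄ (suc (suc zero)) zero _ r≢opp = ⊥-elim (r≢opp refl)
neighbour₄ (suc (suc zero)) (suc zero) _ _ = inj₂ refl
neighbour₄ (suc (suc zero)) (suc (suc zero)) r≢p _ = ⊥-elim (r≢p refl)
neighbour₄ (suc (suc zero)) (suc (suc (suc zero))) _ _ = inj₁ refl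
neighbour₄ (suc (suc (suc zero))) zero _ _ = inj₁ refl
neighbour₄ (suc (suc (suc zero))) (suc zero) _ r≢opp = ⊥-elim (r≢opp refl)
neighbour₄ (suc (suc (suc zero))) (suc (suc zero)) _ _ = inj₂ refl
neighbour₄ (suc (suc (suc zero))) (suc (suc (suc zero))) r≢p _ = ⊥-elim (r≢p refl)

cycOrder⇒4≤length : ∀ {A : Set} {r : List A} {a b c d} → CycOrder r a b c d → 4 ≤ length r
cycOrder⇒4≤length (xs , ys , refl , sublist) = begin
  4                      ≤⟨ SublistP.length-mono-≤ sublist ⟩
  length (ys ++ xs)      ≡⟨ ListP.length-++ ys ⟩
  length ys + length xs  ≡⟨ ℕP.+-comm (length ys) (length xs) ⟩
  length xs + length ys  ≡⟨ ListP.length-++ xs ⟨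
  length (xs ++ ys)      ∎
  where open ℕP.≤-Reasoning

suc₄≢ : ∀ p → suc₄ p ≢ p
suc₄≢ zero ()
suc₄≢ (suc zero) ()
suc₄≢ (suc (suc zero)) ()
suc₄≢ (suc (suc (suc zero))) ()

suc₄²≢ : ∀ p → suc₄ (suc₄ p) ≢ p
suc₄²≢ zero ()
suc₄²≢ (suc zero) ()
suc₄²≢ (suc (suc zero)) ()
suc₄²≢ (suc (suc (suc zero))) ()

data Relative : Fin 4 → Fin 4 → Set where
  same     : ∀ {p} → Relative p p
  next     : ∀ {p} → Relative p (suc₄ p)
  opposite : ∀ {p} → Relative p (suc₄ (suc₄ p))
  previous : ∀ {p} → Relative (suc₄ p) p

relative : ∀ p p' → Relative p p'
relative zero zero = same
relative zero (suc zero) = next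
relative zero (suc (suc zero)) = opposite
relative zero (suc (suc (suc zero))) = previous
relative (suc zero) zero = previous
relative (suc zero) (suc zero) = same
relative (suc zero) (suc (suc zero)) = next
relative (suc zero) (suc (suc (suc zero))) = opposite
relative (suc (suc zero)) zero = opposite
relative (suc (suc zero)) (suc zero) = previous
relative (suc (suc zero)) (suc (suc zero)) = same
relative (suc (suc zero)) (suc (suc (suc zero))) = next
relative (suc (suc (suc zero))) zero = next
relative (suc (suc (suc zero))) (suc zero) = opposite
relative (suc (suc (suc zero))) (suc (suc zero)) = previous
relative (suc (suc (suc zero))) (suc (suc (suc zero))) = same

crosses⇒4≤length : ∀ {A : Set} {r : List A} {a b c d} → Crosses r a b c d → 4 ≤ length r
crosses⇒4≤length (inj₁ order) = cycOrder⇒4≤length order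
crosses⇒4≤length (inj₂ order) = cycOrder⇒4≤length order

length≡4 : ∀ {A : Set} (xs : List A) → length xs ≡ 4 →
           Σ A λ a₀ → Σ A λ a₁ → Σ A λ a₂ → Σ A λ a₃ → xs ≡ a₀ ∷ a₁ ∷ a₂ ∷ a₃ ∷ []
length≡4 (a₀ ∷ a₁ ∷ a₂ ∷ a₃ ∷ []) refl = a₀ , a₁ , a₂ , a₃ , refl

module Quadruple {A : Set} (a₀ a₁ a₂ a₃ : A) where

  quad : List A
  quad = a₀ ∷ a₁ ∷ a₂ ∷ a₃ ∷ []

  at : Fin 4 → A
  at = lookup quad

  cycOrder-at : ∀ p → CycOrder quad (at p) (at (suc₄ p)) (at (suc₄ (suc₄ p))) (at (pred₄ p))
  cycOrder-at zero = [] , _ , refl , refl ∷ refl ∷ refl ∷ refl ∷ []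
  cycOrder-at (suc zero) = a₀ ∷ [] , _ , refl , refl ∷ refl ∷ refl ∷ refl ∷ []
  cycOrder-at (suc (suc zero)) = a₀ ∷ a₁ ∷ [] , _ , refl , refl ∷ refl ∷ refl ∷ refl ∷ []
  cycOrder-at (suc (suc (suc zero))) = a₀ ∷ a₁ ∷ a₂ ∷ [] , _ , refl , refl ∷ refl ∷ refl ∷ refl ∷ []

  crosses-opposite : ∀ p r r' {e e' g g'} → at p ≡ e → at (suc₄ (suc₄ p)) ≡ e' → at r ≡ g → at r' ≡ g' →
                     r ≢ p → r ≢ suc₄ (suc₄ p) → r' ≢ p → r' ≢ suc₄ (suc₄ p) → r ≢ r' → Crosses quad e e' g g'
  crosses-opposite p r r' refl refl refl refl r≢p r≢opp r'≢p r'≢opp r≢r'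
    with neighbour₄ p r r≢p r≢opp | neighbour₄ p r' r'≢p r'≢opp
  ... | inj₁ refl | inj₁ refl = ⊥-elim (r≢r' refl)
  ... | inj₁ refl | inj₂ refl = inj₁ (cycOrder-at p)
  ... | inj₂ refl | inj₁ refl = inj₂ (cycOrder-at p)
  ... | inj₂ refl | inj₂ refl = ⊥-elim (r≢r' refl)

  cycOrder-positions : ∀ {a b c d} → CycOrder quad a b c d →
                       Σ (Fin 4) λ s → a ≡ at s × b ≡ at (suc₄ s) × c ≡ at (suc₄ (suc₄ s)) × d ≡ at (pred₄ s)
  cycOrder-positions ([] , _ , refl , sublist) with SublistP.toPointwise refl sublist
  ... | refl ∷ refl ∷ refl ∷ refl ∷ [] = zero , refl , refl , refl , refl
  cycOrder-positions ((_ ∷ []) , _ , refl , sublist) with SublistP.toPointwise refl sublist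
  ... | refl ∷ refl ∷ refl ∷ refl ∷ [] = suc zero , refl , refl , refl , refl
  cycOrder-positions ((_ ∷ _ ∷ []) , _ , refl , sublist) with SublistP.toPointwise refl sublist
  ... | refl ∷ refl ∷ refl ∷ refl ∷ [] = suc (suc zero) , refl , refl , refl , refl
  cycOrder-positions ((_ ∷ _ ∷ _ ∷ []) , _ , refl , sublist) with SublistP.toPointwise refl sublist
  ... | refl ∷ refl ∷ refl ∷ refl ∷ [] = suc (suc (suc zero)) , refl , refl , refl , refl
  cycOrder-positions ((_ ∷ _ ∷ _ ∷ _ ∷ []) , [] , refl , sublist) with SublistP.toPointwise refl sublist
  ... | refl ∷ refl ∷ refl ∷ refl ∷ [] = zero , refl , refl , refl , refl

  crosses-neighbours : ∀ {e e' g g'} → Crosses quad e e' g g' →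
                       Σ (Fin 4) λ s → e ≡ at s × (at (suc₄ s) ≡ g ⊎ at (suc₄ s) ≡ g')
                                              × (at (pred₄ s) ≡ g ⊎ at (pred₄ s) ≡ g')
  crosses-neighbours (inj₁ order) with cycOrder-positions order
  ... | s , e≡ , g≡ , _ , g'≡ = s , e≡ , inj₁ (sym g≡) , inj₂ (sym g'≡)
  crosses-neighbours (inj₂ order) with cycOrder-positions order
  ... | s , e≡ , g'≡ , _ , g≡ = s , e≡ , inj₂ (sym g'≡) , inj₁ (sym g≡)

sum-tabulate-≡0 : ∀ {l} (f : Fin l → ℕ) → (∀ j → f j ≡ 0) → sum (tabulate f) ≡ 0
sum-tabulate-≡0 {zero} f f≡0 = refl
sum-tabulate-≡0 {suc l} f f≡0 rewrite f≡0 zero = sum-tabulate-≡0 (λ j → f (suc j)) (λ j → f≡0 (suc j))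

sum-tabulate-single : ∀ {l} (f : Fin l → ℕ) j → f j ≡ 1 → (∀ j' → j' ≢ j → f j' ≡ 0) → sum (tabulate f) ≡ 1
sum-tabulate-single {suc l} f zero fj≡1 rest≡0 rewrite fj≡1 =
  cong suc (sum-tabulate-≡0 (λ j → f (suc j)) (λ j → rest≡0 (suc j) λ ()))
sum-tabulate-single {suc l} f (suc j) fj≡1 rest≡0 rewrite rest≡0 zero (λ ()) =
  sum-tabulate-single (λ j → f (suc j)) j fj≡1 (λ j' j'≢j → rest≡0 (suc j') (j'≢j ∘ FinP.suc-injective))

ind-yes : ∀ {P : Set} → P → (d : Dec P) → ind d ≡ 1
ind-yes _ (yes _) = refl
ind-yes p (no ¬p) = ⊥-elim (¬p p)

ind-no : ∀ {P : Set} → ¬ P → (d : Dec P) → ind d ≡ 0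
ind-no ¬p (yes p) = ⊥-elim (¬p p)
ind-no _ (no _) = refl

endOf? : ∀ {n k} (H : Demand n k) j v → Dec (EndOf H j v)
endOf? H j v = (v FinP.≟ hs H j) ⊎-dec (v FinP.≟ ht H j)

module MatchingDegree {n k} (H : Demand n k) (matching : IsMatching H) where

  private
    count : Fin n → Fin k → ℕ
    count v j = ind (v FinP.≟ hs H j) + ind (v FinP.≟ ht H j)

    degH-tabulate : ∀ v → degH H v ≡ sum (tabulate (count v))
    degH-tabulate v = cong sum (ListP.map-tabulate id (count v))

  end⇒degH≡1 : ∀ j v → EndOf H j v → degH H v ≡ 1
  end⇒degH≡1 j v end = trans (degH-tabulate v) (sum-tabulate-single (count v) j (count-j end) count-others)
    where
    count-j : EndOf H j v → count v j ≡ 1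
    count-j (inj₁ v≡s) rewrite ind-yes v≡s (v FinP.≟ hs H j)
                             | ind-no (λ v≡t → proj₁ matching j (trans (sym v≡s) v≡t)) (v FinP.≟ ht H j) = refl
    count-j (inj₂ v≡t) rewrite ind-yes v≡t (v FinP.≟ ht H j)
                             | ind-no (λ v≡s → proj₁ matching j (trans (sym v≡s) v≡t)) (v FinP.≟ hs H j) = refl
    count-others : ∀ j' → j' ≢ j → count v j' ≡ 0
    count-others j' j'≢j rewrite ind-no (λ v≡s → j'≢j (proj₂ matching j' j v (inj₁ v≡s) end)) (v FinP.≟ hs H j')
                               | ind-no (λ v≡t → j'≢j (proj₂ matching j' j v (inj₂ v≡t) end)) (v FinP.≟ ht H j') = refl

  ¬end⇒degH≡0 : ∀ v → (∀ j → ¬ EndOf H j v) → degH H v ≡ 0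
  ¬end⇒degH≡0 v ¬end = trans (degH-tabulate v) (sum-tabulate-≡0 (count v) count≡0)
    where
    count≡0 : ∀ j → count v j ≡ 0
    count≡0 j rewrite ind-no (λ v≡s → ¬end j (inj₁ v≡s)) (v FinP.≟ hs H j)
                    | ind-no (λ v≡t → ¬end j (inj₂ v≡t)) (v FinP.≟ ht H j) = refl

  degH≡0⊎degH≡1 : ∀ v → degH H v ≡ 0 ⊎ degH H v ≡ 1
  degH≡0⊎degH≡1 v with FinP.any? (λ j → endOf? H j v)
  ... | yes (j , end) = inj₂ (end⇒degH≡1 j v end)
  ... | no ¬end = inj₁ (¬end⇒degH≡0 v λ j end → ¬end (j , end))

consecutive⇒inject₁≡suc : ∀ {l} {a b : Fin l} → Consecutive a b → inject₁ b ≡ suc a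
consecutive⇒inject₁≡suc {b = b} ab = FinP.toℕ-injective (trans (FinP.toℕ-inject₁ b) ab)

Incident : ∀ {n m} → EmbGraph n m → Fin m → Fin n → Set
Incident G e v = src G e ≡ v ⊎ tgt G e ≡ v

module Incidence {n m} (G : EmbGraph n m) where

  ∈rot⇒incident : ∀ {v e} → e ∈ rot G v → Incident G e v
  ∈rot⇒incident {v} {e} = Equivalence.to (rot-complete G v e)

  incident⇒∈rot : ∀ {v e} → Incident G e v → e ∈ rot G v
  incident⇒∈rot {v} {e} = Equivalence.from (rot-complete G v e)

  joins⇒∈rotˡ : ∀ {e u w} → Joins G e u w → e ∈ rot G u
  joins⇒∈rotˡ (inj₁ (src≡u , _)) = incident⇒∈rot (inj₁ src≡u)
  joins⇒∈rotˡ (inj₂ (_ , tgt≡u)) = incident⇒∈rot (inj₂ tgt≡u)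

  joins⇒∈rotʳ : ∀ {e u w} → Joins G e u w → e ∈ rot G w
  joins⇒∈rotʳ (inj₁ (_ , tgt≡w)) = incident⇒∈rot (inj₂ tgt≡w)
  joins⇒∈rotʳ (inj₂ (src≡w , _)) = incident⇒∈rot (inj₁ src≡w)

  joins-sym : ∀ {e u w} → Joins G e u w → Joins G e w u
  joins-sym (inj₁ p) = inj₂ p
  joins-sym (inj₂ p) = inj₁ p

  joins-back : ∀ {e u v w} → Joins G e u v → Joins G e v w → u ≡ w
  joins-back (inj₁ (a , b)) (inj₁ (c , d)) = trans (sym a) (trans c (trans (sym b) d))
  joins-back (inj₁ (a , _)) (inj₂ (c , _)) = trans (sym a) c
  joins-back (inj₂ (_ , b)) (inj₁ (_ , d)) = trans (sym b) d
  joins-back (inj₂ (a , b)) (inj₂ (c , d)) = trans (sym b) (trans d (trans (sym a) c))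

  incident-third : ∀ {e u w v} → Incident G e u → Incident G e w → Incident G e v → u ≢ v → w ≢ v → u ≡ w
  incident-third (inj₁ a) (inj₁ b) _ _ _ = trans (sym a) b
  incident-third (inj₂ a) (inj₂ b) _ _ _ = trans (sym a) b
  incident-third (inj₁ a) (inj₂ b) (inj₁ c) u≢v _ = ⊥-elim (u≢v (trans (sym a) c))
  incident-third (inj₁ a) (inj₂ b) (inj₂ c) _ w≢v = ⊥-elim (w≢v (trans (sym b) c))
  incident-third (inj₂ a) (inj₁ b) (inj₁ c) _ w≢v = ⊥-elim (w≢v (trans (sym b) c))
  incident-third (inj₂ a) (inj₁ b) (inj₂ c) u≢v _ = ⊥-elim (u≢v (trans (sym a) c))

inner-index : ∀ {L} (i : Fin (suc L)) → i ≢ zero → i ≢ fromℕ L →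
              Σ (Fin L) λ a → Σ (Fin L) λ b → Consecutive a b × suc a ≡ i
inner-index zero i≢0 _ = ⊥-elim (i≢0 refl)
inner-index {suc L} (suc a) _ i≢last = a , lower₁ (suc a) L≢ , FinP.toℕ-lower₁ (suc a) L≢ , refl
  where
  L≢ : suc L ≢ toℕ (suc a)
  L≢ eq = i≢last (cong suc (FinP.toℕ-injective (trans (sym (ℕP.suc-injective eq)) (sym (FinP.toℕ-fromℕ L)))))

module PathFacts {n m} (G : EmbGraph n m) {s t} (Q : GPath G s t) where

  open Incidence G

  inner-stop : ∀ i {v} → vert Q i ≡ v → v ≢ s → v ≢ t →
               Σ (Fin (len Q)) λ a → Σ (Fin (len Q)) λ b → Consecutive a b × vert Q (suc a) ≡ v
  inner-stop i i≡v v≢s v≢t with inner-index i (λ i≡0 → v≢s (trans (sym i≡v) (trans (cong (vert Q) i≡0) (start Q))))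
                                             (λ i≡last → v≢t (trans (sym i≡v) (trans (cong (vert Q) i≡last) (finish Q))))
  ... | a , b , ab , suc-a≡i = a , b , ab , trans (cong (vert Q) suc-a≡i) i≡v

  inner-edges : ∀ {a b v} → Consecutive a b → vert Q (suc a) ≡ v →
                edge Q a ∈ rot G v × edge Q b ∈ rot G v × edge Q a ≢ edge Q b
  inner-edges {a} {b} ab refl =
    joins⇒∈rotʳ (joins Q a) , subst (λ u → edge Q b ∈ rot G u) b-starts (joins⇒∈rotˡ (joins Q b)) , distinct
    where
    b-starts : vert Q (inject₁ b) ≡ vert Q (suc a)
    b-starts = cong (vert Q) (consecutive⇒inject₁≡suc ab)
    distinct : edge Q a ≢ edge Q b
    distinct same-edge with simple Q _ _ (joins-back (joins Q a)
      (subst (λ e → Joins G e (vert Q (suc a)) (vert Q (suc b))) (sym same-edge)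
        (subst (λ u → Joins G (edge Q b) u (vert Q (suc b))) b-starts (joins Q b))))
    ... | a≡sb = ℕP.m≢1+n+m (toℕ a) {1} (trans (sym (FinP.toℕ-inject₁ a)) (trans (cong toℕ a≡sb) (cong suc ab)))

  end-edge : s ≢ t → ∀ {v} → v ≡ s ⊎ v ≡ t → Σ (Fin (len Q)) λ a → edge Q a ∈ rot G v
  end-edge s≢t v-end = go (len Q) (vert Q) (edge Q) (joins Q) (λ eq → s≢t (trans (sym (start Q)) (trans eq (finish Q))))
                          (Data.Sum.map (λ eq → trans eq (sym (start Q))) (λ eq → trans eq (sym (finish Q))) v-end)
    where
    go : ∀ L (vert : Fin (suc L) → Fin n) (edge : Fin L → Fin m) → (∀ i → Joins G (edge i) (vert (inject₁ i)) (vert (suc i))) →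
         vert zero ≢ vert (fromℕ L) → ∀ {v} → v ≡ vert zero ⊎ v ≡ vert (fromℕ L) → Σ (Fin L) λ a → edge a ∈ rot G v
    go zero vert edge joined ends-differ _ = ⊥-elim (ends-differ refl)
    go (suc L) vert edge joined _ (inj₁ refl) = zero , joins⇒∈rotˡ (joined zero)
    go (suc L) vert edge joined _ (inj₂ refl) = fromℕ L , joins⇒∈rotʳ (joined (fromℕ L))

-- Arguments ≥ 3 all go to 3; positions in a rotation are < 4 by MaxDeg4.
toFin4 : ℕ → Fin 4
toFin4 0 = zero
toFin4 1 = suc zero
toFin4 2 = suc (suc zero)
toFin4 _ = suc (suc (suc zero))

toFin4-toℕ : ∀ q → toFin4 (toℕ q) ≡ q
toFin4-toℕ zero = refl
toFin4-toℕ (suc zero) = refl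
toFin4-toℕ (suc (suc zero)) = refl
toFin4-toℕ (suc (suc (suc zero))) = refl

toℕ-toFin4 : ∀ i → i < 4 → toℕ (toFin4 i) ≡ i
toℕ-toFin4 0 _ = refl
toℕ-toFin4 1 _ = refl
toℕ-toFin4 2 _ = refl
toℕ-toFin4 3 _ = refl
toℕ-toFin4 (suc (suc (suc (suc i)))) (s≤s (s≤s (s≤s (s≤s ()))))

module Gadgets {n m k} (G : EmbGraph n m) (maxDeg4 : MaxDeg4 G) (H : Demand n k) where

  open Incidence G
  open FirstIndex (FinP._≟_ {m})

  Node : Set
  Node = Node'' G H

  vertexOf : Node → Fin n
  vertexOf (orig v) = v
  vertexOf (cyc v _) = v
  vertexOf (sub v _) = v

  cyc-injective : ∀ {v q q'} → _≡_ {A = Node} (cyc v q) (cyc v q') → q ≡ q'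
  cyc-injective refl = refl

  cyc≢orig : ∀ {u q w} → _≢_ {A = Node} (cyc u q) (orig w)
  cyc≢orig ()

  Rep? : ∀ v → Dec (Rep G H v)
  Rep? v = (degH H v ℕP.≟ 0) ×-dec (deg G v ℕP.≟ 4)

  Tri? : ∀ v → Dec (Tri G H v)
  Tri? v = (degH H v ℕP.≟ 1) ×-dec (deg G v ℕP.≟ 3)

  Rep⇒¬Tri : ∀ {v} → Rep G H v → ¬ Tri G H v
  Rep⇒¬Tri (degH≡0 , _) (degH≡1 , _) with trans (sym degH≡0) degH≡1
  ... | ()

  position : Fin n → Fin m → Fin 4
  position v e = toFin4 (firstIndex e (rot G v))

  firstIndex<4 : ∀ {v e} → e ∈ rot G v → firstIndex e (rot G v) < 4
  firstIndex<4 {v} e∈ = ℕP.<-≤-trans (nth-< (rot G v) _ (nth-firstIndex (rot G v) e∈)) (maxDeg4 v)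

  position-nth : ∀ {v e} → e ∈ rot G v → nth (rot G v) (toℕ (position v e)) ≡ just e
  position-nth {v} e∈ rewrite toℕ-toFin4 _ (firstIndex<4 e∈) = nth-firstIndex (rot G v) e∈

  position-unique : ∀ {v e} q → nth (rot G v) (toℕ q) ≡ just e → position v e ≡ q
  position-unique {v} q nth≡e =
    trans (cong toFin4 (nth-injective (rot-unique G v) _ _ (nth-firstIndex (rot G v) (nth-∈ (rot G v) _ nth≡e)) nth≡e))
          (toFin4-toℕ q)

  position-injective : ∀ {v e e'} → e ∈ rot G v → e' ∈ rot G v → position v e ≡ position v e' → e ≡ e'
  position-injective {v} e∈ e'∈ eq =
    just-injective (trans (sym (position-nth e∈)) (trans (cong (λ q → nth (rot G v) (toℕ q)) eq) (position-nth e'∈)))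

  attach′ : ∀ v → Fin m → Dec (Rep G H v) → Dec (Tri G H v) → Node
  attach′ v e (yes _) _ = cyc v (position v e)
  attach′ v e (no _) (yes _) = sub v e
  attach′ v e (no _) (no _) = orig v

  attach : Fin n → Fin m → Node
  attach v e = attach′ v e (Rep? v) (Tri? v)

  vertexOf-attach′ : ∀ v e dr dt → vertexOf (attach′ v e dr dt) ≡ v
  vertexOf-attach′ v e (yes _) _ = refl
  vertexOf-attach′ v e (no _) (yes _) = refl
  vertexOf-attach′ v e (no _) (no _) = refl

  vertexOf-attach : ∀ v e → vertexOf (attach v e) ≡ v
  vertexOf-attach v e = vertexOf-attach′ v e (Rep? v) (Tri? v)

  attach-Rep : ∀ {v} e → Rep G H v → attach v e ≡ cyc v (position v e)
  attach-Rep {v} e rep with Rep? v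
  ... | yes _ = refl
  ... | no ¬rep = ⊥-elim (¬rep rep)

  attach-Tri : ∀ {v} e → Tri G H v → attach v e ≡ sub v e
  attach-Tri {v} e tri with Rep? v | Tri? v
  ... | yes rep | _ = ⊥-elim (Rep⇒¬Tri rep tri)
  ... | no _ | yes _ = refl
  ... | no _ | no ¬tri = ⊥-elim (¬tri tri)

  attach-plain : ∀ {v} e → ¬ Rep G H v → ¬ Tri G H v → attach v e ≡ orig v
  attach-plain {v} e ¬rep ¬tri with Rep? v | Tri? v
  ... | yes rep | _ = ⊥-elim (¬rep rep)
  ... | no _ | yes tri = ⊥-elim (¬tri tri)
  ... | no _ | no _ = refl

  attach-cases : ∀ v e → (Rep G H v × attach v e ≡ cyc v (position v e)) ⊎ attach v e ≡ sub v e
                         ⊎ (¬ Rep G H v × ¬ Tri G H v × attach v e ≡ orig v)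
  attach-cases v e with Rep? v | Tri? v
  ... | yes rep | _ = inj₁ (rep , refl)
  ... | no _ | yes _ = inj₂ (inj₁ refl)
  ... | no ¬rep | no ¬tri = inj₂ (inj₂ (¬rep , ¬tri , refl))

  attach≡orig : ∀ {u e v} → attach u e ≡ orig v → u ≡ v × ¬ Rep G H u × ¬ Tri G H u
  attach≡orig {u} eq with Rep? u | Tri? u
  attach≡orig () | yes _ | _
  attach≡orig () | no _ | yes _
  attach≡orig refl | no ¬rep | no ¬tri = refl , ¬rep , ¬tri

  attach≡sub : ∀ {u e v e'} → attach u e ≡ sub v e' → e ≡ e'
  attach≡sub {u} eq with Rep? u | Tri? u
  attach≡sub () | yes _ | _
  attach≡sub refl | no _ | yes _ = refl
  attach≡sub () | no _ | no _

  attach≡cyc : ∀ {u e v q} → attach u e ≡ cyc v q → u ≡ v × Rep G H u × position u e ≡ q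
  attach≡cyc {u} eq with Rep? u | Tri? u
  attach≡cyc refl | yes rep | _ = refl , rep , refl
  attach≡cyc () | no _ | yes _
  attach≡cyc () | no _ | no _

  attach-At : ∀ {v e} → e ∈ rot G v → At G H v e (attach v e)
  attach-At {v} {e} e∈ with Rep? v | Tri? v
  ... | yes rep | _ with nth⇒lookup (rot G v) _ (nth-firstIndex (rot G v) e∈)
  ...   | i , toℕi≡ , lookup≡e = atCyc rep i (position v e) lookup≡e
                                        (trans toℕi≡ (sym (toℕ-toFin4 _ (firstIndex<4 e∈))))
  attach-At {v} {e} e∈ | no _ | yes tri = atSub tri e∈
  attach-At {v} {e} e∈ | no ¬rep | no ¬tri = atOrig ¬rep ¬tri

  cyc≡attach : ∀ {v q e} → Rep G H v → nth (rot G v) (toℕ q) ≡ just e → cyc v q ≡ attach v e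
  cyc≡attach {v} {q} {e} rep nth≡e = trans (cong (cyc v) (sym (position-unique q nth≡e))) (sym (attach-Rep e rep))

  At-cyc : ∀ {w e v q} → At G H w e (cyc v q) → w ≡ v × nth (rot G v) (toℕ q) ≡ just e
  At-cyc {w} (atCyc _ i _ lookup≡e toℕi≡toℕq) =
    refl , trans (cong (nth (rot G w)) (sym toℕi≡toℕq)) (trans (nth-lookup (rot G w) i) (cong just lookup≡e))

  At⇒attach : ∀ {v e x} → At G H v e x → x ≡ attach v e
  At⇒attach at@(atCyc rep _ _ _ _) = cyc≡attach rep (proj₂ (At-cyc at))
  At⇒attach (atSub tri _) = sym (attach-Tri _ tri)
  At⇒attach (atOrig ¬rep ¬tri) = sym (attach-plain _ ¬rep ¬tri)

  vertexOf-At : ∀ {v e x} → At G H v e x → vertexOf x ≡ v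
  vertexOf-At (atCyc _ _ _ _ _) = refl
  vertexOf-At (atSub _ _) = refl
  vertexOf-At (atOrig _ _) = refl

  At⇒attach-vertexOf : ∀ {v e x} → At G H v e x → x ≡ attach (vertexOf x) e
  At⇒attach-vertexOf {e = e} at = trans (At⇒attach at) (cong (λ u → attach u e) (sym (vertexOf-At at)))

  next4≡suc₄ : ∀ q → next4 G H q ≡ suc₄ q
  next4≡suc₄ zero = refl
  next4≡suc₄ (suc zero) = refl
  next4≡suc₄ (suc (suc zero)) = refl
  next4≡suc₄ (suc (suc (suc zero))) = refl

  next4≡⇒pred₄ : ∀ q q' → next4 G H q' ≡ q → q' ≡ pred₄ q
  next4≡⇒pred₄ _ zero refl = refl
  next4≡⇒pred₄ _ (suc zero) refl = refl
  next4≡⇒pred₄ _ (suc (suc zero)) refl = refl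
  next4≡⇒pred₄ _ (suc (suc (suc zero))) refl = refl

  adj''-sym : ∀ {x y} → Adj'' G H x y → Adj'' G H y x
  adj''-sym (inj₁ xy) = inj₂ xy
  adj''-sym (inj₂ yx) = inj₁ yx

  joins⇒adj'' : ∀ {e u w} → Joins G e u w → Adj'' G H (attach u e) (attach w e)
  joins⇒adj'' {e} (inj₁ (refl , refl)) = inj₁ (eG e (attach-At (incident⇒∈rot (inj₁ refl))) (attach-At (incident⇒∈rot (inj₂ refl))))
  joins⇒adj'' {e} (inj₂ (refl , refl)) = inj₂ (eG e (attach-At (incident⇒∈rot (inj₁ refl))) (attach-At (incident⇒∈rot (inj₂ refl))))

  ImageOfEdge : Node → Node → Set
  ImageOfEdge x y = Σ (Fin m) λ e → Joins G e (vertexOf x) (vertexOf y) × x ≡ attach (vertexOf x) e × y ≡ attach (vertexOf y) e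

  edge''-classify : ∀ {x y} → Edge'' G H x y → vertexOf x ≡ vertexOf y ⊎ ImageOfEdge x y
  edge''-classify (eG e at-src at-tgt) =
    inj₂ (e , inj₁ (sym (vertexOf-At at-src) , sym (vertexOf-At at-tgt)) , At⇒attach-vertexOf at-src , At⇒attach-vertexOf at-tgt)
  edge''-classify (eCyc _ _) = inj₁ refl
  edge''-classify (eSpoke _ _) = inj₁ refl
  edge''-classify (eTri _ _ _ _) = inj₁ refl

  adj''-classify : ∀ {x y} → Adj'' G H x y → vertexOf x ≡ vertexOf y ⊎ ImageOfEdge x y
  adj''-classify (inj₁ xy) = edge''-classify xy
  adj''-classify (inj₂ yx) with edge''-classify yx
  ... | inj₁ eq = inj₁ (sym eq)
  ... | inj₂ (e , joins , y≡ , x≡) = inj₂ (e , joins-sym joins , x≡ , y≡)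

module Degrees {n m k} (G : EmbGraph n m) (maxDeg4 : MaxDeg4 G) (H : Demand n k) (matching : IsMatching H)
               (ends-small : ∀ v → degH H v ≡ 1 → deg G v ≤ 3) where

  open MatchingDegree H matching

  4≤deg⇒Rep : ∀ v → 4 ≤ deg G v → Rep G H v
  4≤deg⇒Rep v 4≤deg with degH≡0⊎degH≡1 v
  ... | inj₁ degH≡0 = degH≡0 , ℕP.≤-antisym (maxDeg4 v) 4≤deg
  ... | inj₂ degH≡1 = ⊥-elim (ℕP.<-irrefl refl (ℕP.≤-trans 4≤deg (ends-small v degH≡1)))

  four-incident⇒Rep : ∀ {v a b c d} → a ∈ rot G v → b ∈ rot G v → c ∈ rot G v → d ∈ rot G v →
                      a ≢ b → a ≢ c → a ≢ d → b ≢ c → b ≢ d → c ≢ d → Rep G H v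
  four-incident⇒Rep {v} a∈ b∈ c∈ d∈ a≢b a≢c a≢d b≢c b≢d c≢d =
    4≤deg⇒Rep v (unique⊆⇒length≤ ((a≢b ∷ a≢c ∷ a≢d ∷ []) ∷ (b≢c ∷ b≢d ∷ []) ∷ (c≢d ∷ []) ∷ [] ∷ []) ⊆rot)
    where
    ⊆rot : ∀ {x} → x ∈ _ → x ∈ rot G v
    ⊆rot (here refl) = a∈
    ⊆rot (there (here refl)) = b∈
    ⊆rot (there (there (here refl))) = c∈
    ⊆rot (there (there (there (here refl)))) = d∈

  three-incident⇒Tri : ∀ {v a b c} → degH H v ≡ 1 → a ∈ rot G v → b ∈ rot G v → c ∈ rot G v →
                       a ≢ b → a ≢ c → b ≢ c → Tri G H v
  three-incident⇒Tri {v} degH≡1 a∈ b∈ c∈ a≢b a≢c b≢c =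
    degH≡1 , ℕP.≤-antisym (ends-small v degH≡1) (unique⊆⇒length≤ ((a≢b ∷ a≢c ∷ []) ∷ (b≢c ∷ []) ∷ [] ∷ []) ⊆rot)
    where
    ⊆rot : ∀ {x} → x ∈ _ → x ∈ rot G v
    ⊆rot (here refl) = a∈
    ⊆rot (there (here refl)) = b∈
    ⊆rot (there (there (here refl))) = c∈

  end⇒¬Rep : ∀ j v → EndOf H j v → ¬ Rep G H v
  end⇒¬Rep j v end (degH≡0 , _) with trans (sym (end⇒degH≡1 j v end)) degH≡0
  ... | ()

module Contraction {n m k} (G : EmbGraph n m) (maxDeg4 : MaxDeg4 G) (H : Demand n k) (matching : IsMatching H)
                   (ends-small : ∀ v → degH H v ≡ 1 → deg G v ≤ 3) where

  open Incidence G
  open Gadgets G maxDeg4 H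
  open Degrees G maxDeg4 H matching ends-small
  module W'' = Walks (Adj'' G H)

  External : Fin n → Fin 4 → Node → Set
  External v q y = Σ (Fin m) λ e → nth (rot G v) (toℕ q) ≡ just e × vertexOf y ≢ v
                                  × y ≡ attach (vertexOf y) e × Incident G e (vertexOf y)

  cyc-neighbour : ∀ {v q y} → Adj'' G H y (cyc v q) → y ≡ cyc v (suc₄ q) ⊎ y ≡ cyc v (pred₄ q) ⊎ External v q y
  cyc-neighbour (inj₁ (eG e at-y at-cyc)) with At-cyc at-cyc
  ... | refl , nth≡e = inj₂ (inj₂ (e , nth≡e , (λ eq → loopless G e (trans (sym (vertexOf-At at-y)) eq)) ,
                                   At⇒attach-vertexOf at-y , inj₁ (sym (vertexOf-At at-y))))
  cyc-neighbour (inj₁ (eCyc _ q')) = inj₂ (inj₁ (cong (cyc _) (next4≡⇒pred₄ _ q' refl)))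
  cyc-neighbour (inj₂ (eG e at-cyc at-y)) with At-cyc at-cyc
  ... | refl , nth≡e = inj₂ (inj₂ (e , nth≡e , (λ eq → loopless G e (sym (trans (sym (vertexOf-At at-y)) eq))) ,
                                   At⇒attach-vertexOf at-y , inj₂ (sym (vertexOf-At at-y))))
  cyc-neighbour (inj₂ (eCyc _ q)) = inj₁ (cong (cyc _) (next4≡suc₄ q))

  external-unique : ∀ {v q y y'} → External v q y → External v q y' → y ≡ y'
  external-unique {v} {y = y} {y'} (e , nth≡e , y≢v , y≡ , inc) (e' , nth≡e' , y'≢v , y'≡ , inc')
    with just-injective (trans (sym nth≡e) nth≡e')
  ... | refl = trans y≡ (trans (cong (λ u → attach u e) same-vertex) (sym y'≡))
    where
    same-vertex : vertexOf y ≡ vertexOf y'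
    same-vertex = incident-third inc inc' (∈rot⇒incident (nth-∈ (rot G v) _ nth≡e)) y≢v y'≢v

  cycle-neighbour-on-walk : ∀ {x₀ y₀} {w : W''.Walk x₀ y₀} → W''.Simple w → ∀ {v s} →
                            (∀ q → cyc v q ≢ x₀) → (∀ q → cyc v q ≢ y₀) → cyc v s ∈ W''.vertices w →
                            cyc v (suc₄ s) ∈ W''.vertices w ⊎ cyc v (pred₄ s) ∈ W''.vertices w
  cycle-neighbour-on-walk simple {s = s} ≢x₀ ≢y₀ on-w with W''.inner-neighbours simple on-w (≢x₀ s) (≢y₀ s)
  ... | b , c , b→ , →c , b≢c , b∈ , c∈ with cyc-neighbour b→ | cyc-neighbour (adj''-sym →c)
  ... | inj₁ refl | _ = inj₁ b∈
  ... | inj₂ (inj₁ refl) | _ = inj₂ b∈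
  ... | inj₂ (inj₂ _) | inj₁ refl = inj₁ c∈
  ... | inj₂ (inj₂ _) | inj₂ (inj₁ refl) = inj₂ c∈
  ... | inj₂ (inj₂ ext-b) | inj₂ (inj₂ ext-c) = ⊥-elim (b≢c (external-unique ext-b ext-c))

  module _ {x₀ y₀} {w : W''.Walk x₀ y₀} (simple : W''.Simple w) {v}
           (≢x₀ : ∀ q → cyc v q ≢ x₀) (≢y₀ : ∀ q → cyc v q ≢ y₀)
           (rep : Rep G H v) where

    private
      module _ {a₀ a₁ a₂ a₃} (rot≡ : rot G v ≡ a₀ ∷ a₁ ∷ a₂ ∷ a₃ ∷ []) where
        open Quadruple a₀ a₁ a₂ a₃

        cyc≡attach-at : ∀ q → cyc v q ≡ attach v (at q)
        cyc≡attach-at q = cyc≡attach rep (trans (cong (λ r → nth r (toℕ q)) rot≡) (nth-lookup quad q))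

        attached : ∀ {q g g'} → at q ≡ g ⊎ at q ≡ g' → cyc v q ∈ W''.vertices w →
                   attach v g ∈ W''.vertices w ⊎ attach v g' ∈ W''.vertices w
        attached {q} (inj₁ refl) on = inj₁ (subst (_∈ W''.vertices w) (cyc≡attach-at q) on)
        attached {q} (inj₂ refl) on = inj₂ (subst (_∈ W''.vertices w) (cyc≡attach-at q) on)

        crossing-forces-attachment-quad : ∀ {e e' g g'} → attach v e ∈ W''.vertices w → Crosses quad e e' g g' →
                                          attach v g ∈ W''.vertices w ⊎ attach v g' ∈ W''.vertices w
        crossing-forces-attachment-quad e-on crossing with crosses-neighbours crossing
        ... | s , refl , next-crossed , prev-crossed
          with cycle-neighbour-on-walk simple ≢x₀ ≢y₀ (subst (_∈ W''.vertices w) (sym (cyc≡attach-at s)) e-on)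
        ... | inj₁ next-on = attached next-crossed next-on
        ... | inj₂ prev-on = attached prev-crossed prev-on

    crossing-forces-attachment : ∀ {e e' g g'} → attach v e ∈ W''.vertices w → Crosses (rot G v) e e' g g' →
                                 attach v g ∈ W''.vertices w ⊎ attach v g' ∈ W''.vertices w
    crossing-forces-attachment {e} {e'} {g} {g'} e-on crossing with length≡4 (rot G v) (proj₂ rep)
    ... | _ , _ , _ , _ , rot≡ =
      crossing-forces-attachment-quad rot≡ e-on (subst (λ r → Crosses r e e' g g') rot≡ crossing)

  GStep : Fin n → Fin n → Set
  GStep u w = Σ (Fin m) λ e → Joins G e u w

  module WG = Walks GStep
  open WG.Shortcut FinP._≟_ using (shortcut; shortcut-simple; shortcut-All)

  Covered : List Node → ∀ {u w} → GStep u w → Set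
  Covered S {u} {w} (e , _) = attach u e ∈ S × attach w e ∈ S

  project : ∀ {x y u} → vertexOf x ≡ u → (w : W''.Walk x y) {S : List Node} → (∀ {a} → a ∈ W''.vertices w → a ∈ S) →
            Σ (WG.Walk u (vertexOf y)) (WG.AllSteps (Covered S))
  project refl ε _ = ε , WG.ε
  project refl (step ◅ w) {S} ⊆S with adj''-classify step
  ... | inj₁ x≡y = project (sym x≡y) w (⊆S ∘ there)
  ... | inj₂ (e , joins , x≡ , y≡) with project refl w (⊆S ∘ there)
  ...   | w' , covered =
    (e , joins) ◅ w' , (subst (_∈ S) x≡ (⊆S (here refl)) , subst (_∈ S) y≡ (⊆S (there (W''.head-∈ w)))) WG.◅ covered

  simpleWalk⇒GPath : ∀ {s t t'} (w : WG.Walk s t') → WG.Simple w → t' ≡ t → GPath G s t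
  simpleWalk⇒GPath w simple t'≡t = record
    { len = WG.steps w ; vert = WG.vertexAt w ; edge = λ i → proj₁ (WG.stepAt w i)
    ; start = WG.vertexAt-zero w ; finish = trans (WG.vertexAt-last w) t'≡t ; joins = λ i → proj₂ (WG.stepAt w i)
    ; simple = WG.vertexAt-injective simple }

  module FromDisjointPaths (P'' : ∀ j → Path'' G H (orig (hs H j)) (orig (ht H j)))
                           (disjoint : ∀ j j' → j ≢ j' → ∀ a b → vert'' (P'' j) a ≢ vert'' (P'' j') b) where

    W : ∀ j → W''.Walk (vert'' (P'' j) zero) (vert'' (P'' j) (fromℕ (len'' (P'' j))))
    W j = W''.fromSequence (len'' (P'' j)) (vert'' (P'' j)) (adj'' (P'' j))

    nodes : Fin k → List Node
    nodes j = W''.vertices (W j)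

    nodes-disjoint : ∀ {j j' x} → j ≢ j' → x ∈ nodes j → x ∈ nodes j' → ⊥
    nodes-disjoint {j} {j'} j≢j' x∈ x∈' with W''.fromSequence-∈ _ _ _ x∈ | W''.fromSequence-∈ _ _ _ x∈'
    ... | a , eq | b , eq' = disjoint j j' j≢j' a b (trans eq (sym eq'))

    projected : ∀ j → Σ (WG.Walk (hs H j) (vertexOf (vert'' (P'' j) (fromℕ (len'' (P'' j)))))) (WG.AllSteps (Covered (nodes j)))
    projected j = project (cong vertexOf (start'' (P'' j))) (W j) id

    P : ∀ j → GPath G (hs H j) (ht H j)
    P j = simpleWalk⇒GPath (shortcut (proj₁ (projected j))) (shortcut-simple (proj₁ (projected j)))
                           (cong vertexOf (finish'' (P'' j)))

    covered : ∀ j i → attach (vert (P j) (inject₁ i)) (edge (P j) i) ∈ nodes j × attach (vert (P j) (suc i)) (edge (P j) i) ∈ nodes j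
    covered j = WG.stepAt-All (shortcut-All (proj₂ (projected j)))

    edge-disjoint : ∀ j j' → j ≢ j' → ∀ a b → edge (P j) a ≢ edge (P j') b
    edge-disjoint j j' j≢j' a b same-edge =
      nodes-disjoint j≢j' (covers-src (joins (P j) a) (covered j a))
        (subst (λ e → attach (src G e) e ∈ nodes j') (sym same-edge) (covers-src (joins (P j') b) (covered j' b)))
      where
      covers-src : ∀ {S e u w} → Joins G e u w → attach u e ∈ S × attach w e ∈ S → attach (src G e) e ∈ S
      covers-src (inj₁ (refl , _)) (u-on , _) = u-on
      covers-src (inj₂ (refl , _)) (_ , w-on) = w-on

    uncrossed : ∀ j j' → j ≢ j' → Uncrossed G (P j) (P j')
    uncrossed j j' j≢j' a b c d _ cd v≡ crossing
      with crossing-forces-attachment (W''.fromSequence-simple _ _ _ (simple'' (P'' j)))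
             (λ _ eq → cyc≢orig (trans eq (start'' (P'' j)))) (λ _ eq → cyc≢orig (trans eq (finish'' (P'' j))))
             (4≤deg⇒Rep _ (crosses⇒4≤length crossing)) (proj₂ (covered j a)) crossing
    ... | inj₁ g-on = nodes-disjoint j≢j' g-on (subst (λ u → attach u (edge (P j') c) ∈ nodes j') (sym v≡) (proj₂ (covered j' c)))
    ... | inj₂ g'-on = nodes-disjoint j≢j' g'-on (subst (λ u → attach u (edge (P j') d) ∈ nodes j') (sym v≡') (proj₁ (covered j' d)))
      where
      v≡' : vert (P j) (suc a) ≡ vert (P j') (inject₁ d)
      v≡' = trans v≡ (cong (vert (P j')) (sym (consecutive⇒inject₁≡suc cd)))

  disjointPaths⇒uncrossedFlow : DisjointPaths'' G H → UncrossedFlow G H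
  disjointPaths⇒uncrossedFlow (P'' , disjoint) = P , λ j j' j≢j' → edge-disjoint j j' j≢j' , uncrossed j j' j≢j'
    where open FromDisjointPaths P'' disjoint

module Expansion {n m k} (G : EmbGraph n m) (maxDeg4 : MaxDeg4 G) (H : Demand n k) (matching : IsMatching H)
                 (ends-small : ∀ v → degH H v ≡ 1 → deg G v ≤ 3) where

  open Incidence G
  open Gadgets G maxDeg4 H
  open Degrees G maxDeg4 H matching ends-small
  open MatchingDegree H matching
  module W'' = Walks (Adj'' G H)

  module _ {v} (rep : Rep G H v) where

    cycle-step : ∀ p → Adj'' G H (cyc v p) (cyc v (suc₄ p))
    cycle-step p = subst (λ q → Adj'' G H (cyc v p) (cyc v q)) (next4≡suc₄ p) (inj₁ (eCyc rep p))

    arc : ∀ {p p'} → Relative p p' → W''.Walk (cyc v p) (cyc v p')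
    arc same = ε
    arc (next {p}) = cycle-step p ◅ ε
    arc (opposite {p}) = cycle-step p ◅ cycle-step (suc₄ p) ◅ ε
    arc (previous {p}) = adj''-sym (cycle-step p) ◅ ε

    arc-∈ : ∀ {p p' x} (rel : Relative p p') → x ∈ W''.vertices (arc rel) →
            x ≡ cyc v p ⊎ x ≡ cyc v p' ⊎ (x ≡ cyc v (suc₄ p) × p' ≡ suc₄ (suc₄ p))
    arc-∈ same (here refl) = inj₁ refl
    arc-∈ next (here refl) = inj₁ refl
    arc-∈ next (there (here refl)) = inj₂ (inj₁ refl)
    arc-∈ opposite (here refl) = inj₁ refl
    arc-∈ opposite (there (here refl)) = inj₂ (inj₂ (refl , refl))
    arc-∈ opposite (there (there (here refl))) = inj₂ (inj₁ refl)
    arc-∈ previous (here refl) = inj₁ refl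
    arc-∈ previous (there (here refl)) = inj₂ (inj₁ refl)

    arc-simple : ∀ {p p'} (rel : Relative p p') → W''.Simple (arc rel)
    arc-simple same = W''.ε
    arc-simple (next {p}) = (λ { (here eq) → suc₄≢ p (sym (cyc-injective eq)) }) W''.◅ W''.ε
    arc-simple (opposite {p}) =
      (λ { (here eq) → suc₄≢ p (sym (cyc-injective eq)) ; (there (here eq)) → suc₄²≢ p (sym (cyc-injective eq)) })
      W''.◅ (λ { (here eq) → suc₄≢ (suc₄ p) (sym (cyc-injective eq)) }) W''.◅ W''.ε
    arc-simple (previous {p}) = (λ { (here eq) → suc₄≢ p (cyc-injective eq) }) W''.◅ W''.ε

  MiddleOfOpposite : Fin n → Fin m → Fin m → Node → Set
  MiddleOfOpposite v e e' x =
    Rep G H v × x ≡ cyc v (suc₄ (position v e)) × position v e' ≡ suc₄ (suc₄ (position v e))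

  module _ (v : Fin n) (e e' : Fin m) (e∈ : e ∈ rot G v) (e'∈ : e' ∈ rot G v) where

    through : (dr : Dec (Rep G H v)) (dt : Dec (Tri G H v)) → W''.Walk (attach′ v e dr dt) (attach′ v e' dr dt)
    through (yes rep) _ = arc rep (relative _ _)
    through (no _) (yes tri) with e FinP.≟ e'
    ... | yes refl = ε
    ... | no e≢e' = inj₁ (eTri tri e∈ e'∈ e≢e') ◅ ε
    through (no _) (no _) = ε

    through-∈ : ∀ dr dt {x} → x ∈ W''.vertices (through dr dt) →
                x ≡ attach′ v e dr dt ⊎ x ≡ attach′ v e' dr dt ⊎ MiddleOfOpposite v e e' x
    through-∈ (yes rep) _ x∈ with arc-∈ rep (relative _ _) x∈
    ... | inj₁ x≡ = inj₁ x≡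
    ... | inj₂ (inj₁ x≡) = inj₂ (inj₁ x≡)
    ... | inj₂ (inj₂ (x≡ , opp)) = inj₂ (inj₂ (rep , x≡ , opp))
    through-∈ (no _) (yes tri) x∈ with e FinP.≟ e'
    through-∈ (no _) (yes tri) (here refl) | yes refl = inj₁ refl
    through-∈ (no _) (yes tri) (here refl) | no _ = inj₁ refl
    through-∈ (no _) (yes tri) (there (here refl)) | no _ = inj₂ (inj₁ refl)
    through-∈ (no _) (no _) (here refl) = inj₁ refl

    through-simple : ∀ dr dt → W''.Simple (through dr dt)
    through-simple (yes rep) _ = arc-simple rep (relative _ _)
    through-simple (no _) (yes tri) with e FinP.≟ e'
    ... | yes refl = W''.ε
    ... | no e≢e' = (λ { (here eq) → e≢e' (sub-injective eq) }) W''.◅ W''.ε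
      where
      sub-injective : _≡_ {A = Node} (sub v e) (sub v e') → e ≡ e'
      sub-injective refl = refl
    through-simple (no _) (no _) = W''.ε

    vertexOf-through : ∀ dr dt {x} → x ∈ W''.vertices (through dr dt) → vertexOf x ≡ v
    vertexOf-through dr dt x∈ with through-∈ dr dt x∈
    ... | inj₁ refl = vertexOf-attach′ v e dr dt
    ... | inj₂ (inj₁ refl) = vertexOf-attach′ v e' dr dt
    ... | inj₂ (inj₂ (_ , refl , _)) = refl

  module _ (v : Fin n) (e : Fin m) (¬rep : ¬ Rep G H v) (e∈ : e ∈ rot G v) where

    depart : (dr : Dec (Rep G H v)) (dt : Dec (Tri G H v)) → W''.Walk (orig v) (attach′ v e dr dt)
    depart (yes rep) _ = ⊥-elim (¬rep rep)
    depart (no _) (yes tri) = inj₁ (eSpoke tri e∈) ◅ ε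
    depart (no _) (no _) = ε

    depart-∈ : ∀ dr dt {x} → x ∈ W''.vertices (depart dr dt) → x ≡ orig v ⊎ x ≡ attach′ v e dr dt
    depart-∈ (yes rep) _ _ = ⊥-elim (¬rep rep)
    depart-∈ (no _) (yes _) (here refl) = inj₁ refl
    depart-∈ (no _) (yes _) (there (here refl)) = inj₂ refl
    depart-∈ (no _) (no _) (here refl) = inj₁ refl

    depart-simple : ∀ dr dt → W''.Simple (depart dr dt)
    depart-simple (yes rep) _ = ⊥-elim (¬rep rep)
    depart-simple (no _) (yes _) = (λ { (here ()) }) W''.◅ W''.ε
    depart-simple (no _) (no _) = W''.ε

    arrive : (dr : Dec (Rep G H v)) (dt : Dec (Tri G H v)) → W''.Walk (attach′ v e dr dt) (orig v)
    arrive (yes rep) _ = ⊥-elim (¬rep rep)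
    arrive (no _) (yes tri) = inj₂ (eSpoke tri e∈) ◅ ε
    arrive (no _) (no _) = ε

    arrive-∈ : ∀ dr dt {x} → x ∈ W''.vertices (arrive dr dt) → x ≡ attach′ v e dr dt ⊎ x ≡ orig v
    arrive-∈ (yes rep) _ _ = ⊥-elim (¬rep rep)
    arrive-∈ (no _) (yes _) (here refl) = inj₁ refl
    arrive-∈ (no _) (yes _) (there (here refl)) = inj₂ refl
    arrive-∈ (no _) (no _) (here refl) = inj₁ refl

    arrive-simple : ∀ dr dt → W''.Simple (arrive dr dt)
    arrive-simple (yes rep) _ = ⊥-elim (¬rep rep)
    arrive-simple (no _) (yes _) = (λ { (here ()) }) W''.◅ W''.ε
    arrive-simple (no _) (no _) = W''.ε

  record Route (L : ℕ) : Set where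
    field
      stop   : Fin (suc L) → Fin n
      via    : Fin L → Fin m
      joined : ∀ i → Joins G (via i) (stop (inject₁ i)) (stop (suc i))

    first : Fin n
    first = stop zero

    last : Fin n
    last = stop (fromℕ L)

  open Route

  tail : ∀ {L} → Route (suc L) → Route L
  tail ρ = record { stop = stop ρ ∘ suc ; via = via ρ ∘ suc ; joined = joined ρ ∘ suc }

  module _ {L} (ρ : Route (suc L)) where

    via₀∈ˡ : via ρ zero ∈ rot G (first ρ)
    via₀∈ˡ = joins⇒∈rotˡ (joined ρ zero)

    via₀∈ʳ : via ρ zero ∈ rot G (first (tail ρ))
    via₀∈ʳ = joins⇒∈rotʳ (joined ρ zero)

    throughFirst : ∀ e₀ → e₀ ∈ rot G (first ρ) → W''.Walk (attach (first ρ) e₀) (attach (first ρ) (via ρ zero))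
    throughFirst e₀ e₀∈ = through (first ρ) e₀ (via ρ zero) e₀∈ via₀∈ˡ (Rep? _) (Tri? _)

    departFirst : ¬ Rep G H (first ρ) → W''.Walk (orig (first ρ)) (attach (first ρ) (via ρ zero))
    departFirst ¬rep = depart (first ρ) (via ρ zero) ¬rep via₀∈ˡ (Rep? _) (Tri? _)

  expandFrom : ∀ {L} (ρ : Route L) e₀ → e₀ ∈ rot G (first ρ) → ¬ Rep G H (last ρ) →
               W''.Walk (attach (first ρ) e₀) (orig (last ρ))
  expandFrom {zero} ρ e₀ e₀∈ ¬rep = arrive (first ρ) e₀ ¬rep e₀∈ (Rep? _) (Tri? _)
  expandFrom {suc L} ρ e₀ e₀∈ ¬rep =
    throughFirst ρ e₀ e₀∈ ◅◅ joins⇒adj'' (joined ρ zero) ◅ expandFrom (tail ρ) (via ρ zero) (via₀∈ʳ ρ) ¬rep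

  expand : ∀ {L} (ρ : Route L) → ¬ Rep G H (first ρ) → ¬ Rep G H (last ρ) → W''.Walk (orig (first ρ)) (orig (last ρ))
  expand {zero} ρ _ _ = ε
  expand {suc L} ρ ¬rep₀ ¬rep =
    departFirst ρ ¬rep₀ ◅◅ joins⇒adj'' (joined ρ zero) ◅ expandFrom (tail ρ) (via ρ zero) (via₀∈ʳ ρ) ¬rep

  InjectiveStops : ∀ {L} → Route L → Set
  InjectiveStops ρ = ∀ i i' → stop ρ i ≡ stop ρ i' → i ≡ i'

  expandFrom-vertexOf : ∀ {L} (ρ : Route L) e₀ e₀∈ ¬rep {x} → x ∈ W''.vertices (expandFrom ρ e₀ e₀∈ ¬rep) →
                        Σ (Fin (suc L)) λ i → vertexOf x ≡ stop ρ i
  expandFrom-vertexOf {zero} ρ e₀ e₀∈ ¬rep x∈ with arrive-∈ (first ρ) e₀ ¬rep e₀∈ (Rep? _) (Tri? _) x∈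
  ... | inj₁ refl = zero , vertexOf-attach (first ρ) e₀
  ... | inj₂ refl = zero , refl
  expandFrom-vertexOf {suc L} ρ e₀ e₀∈ ¬rep x∈ with W''.∈-◅◅⁻ (throughFirst ρ e₀ e₀∈) (joins⇒adj'' (joined ρ zero)) _ x∈
  ... | inj₁ x∈through = zero , vertexOf-through (first ρ) e₀ (via ρ zero) e₀∈ (via₀∈ˡ ρ) (Rep? _) (Tri? _) x∈through
  ... | inj₂ x∈rest with expandFrom-vertexOf (tail ρ) (via ρ zero) (via₀∈ʳ ρ) ¬rep x∈rest
  ...   | i , x≡ = suc i , x≡

  first∉expandFrom-tail : ∀ {L} (ρ : Route (suc L)) ¬rep → InjectiveStops ρ → ∀ {a} → vertexOf a ≡ first ρ →
                          a ∉ W''.vertices (expandFrom (tail ρ) (via ρ zero) (via₀∈ʳ ρ) ¬rep)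
  first∉expandFrom-tail ρ ¬rep injective a≡ a∈ with expandFrom-vertexOf (tail ρ) (via ρ zero) (via₀∈ʳ ρ) ¬rep a∈
  ... | i , a≡' with injective zero (suc i) (trans (sym a≡) a≡')
  ... | ()

  expandFrom-simple : ∀ {L} (ρ : Route L) e₀ e₀∈ ¬rep → InjectiveStops ρ → W''.Simple (expandFrom ρ e₀ e₀∈ ¬rep)
  expandFrom-simple {zero} ρ e₀ e₀∈ ¬rep _ = arrive-simple (first ρ) e₀ ¬rep e₀∈ (Rep? _) (Tri? _)
  expandFrom-simple {suc L} ρ e₀ e₀∈ ¬rep injective =
    W''.simple-◅◅ _ (through-simple (first ρ) e₀ (via ρ zero) e₀∈ (via₀∈ˡ ρ) (Rep? _) (Tri? _))
      (expandFrom-simple (tail ρ) (via ρ zero) (via₀∈ʳ ρ) ¬rep (λ i i' eq → FinP.suc-injective (injective (suc i) (suc i') eq)))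
      (λ a a∈ → first∉expandFrom-tail ρ ¬rep injective
                  (vertexOf-through (first ρ) e₀ (via ρ zero) e₀∈ (via₀∈ˡ ρ) (Rep? _) (Tri? _) a∈))

  expand-simple : ∀ {L} (ρ : Route L) ¬rep₀ ¬rep → InjectiveStops ρ → W''.Simple (expand ρ ¬rep₀ ¬rep)
  expand-simple {zero} ρ _ _ _ = W''.ε
  expand-simple {suc L} ρ ¬rep₀ ¬rep injective =
    W''.simple-◅◅ _ (depart-simple (first ρ) (via ρ zero) ¬rep₀ (via₀∈ˡ ρ) (Rep? _) (Tri? _))
      (expandFrom-simple (tail ρ) (via ρ zero) (via₀∈ʳ ρ) ¬rep (λ i i' eq → FinP.suc-injective (injective (suc i) (suc i') eq)))
      (λ a a∈ → first∉expandFrom-tail ρ ¬rep injective (vertexOf-depart a∈))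
    where
    vertexOf-depart : ∀ {a} → a ∈ W''.vertices (departFirst ρ ¬rep₀) → vertexOf a ≡ first ρ
    vertexOf-depart a∈ with depart-∈ (first ρ) (via ρ zero) ¬rep₀ (via₀∈ˡ ρ) (Rep? _) (Tri? _) a∈
    ... | inj₁ refl = refl
    ... | inj₂ refl = vertexOf-attach (first ρ) (via ρ zero)

  OnExpansion : ∀ {L} → Route L → Node → Set
  OnExpansion {L} ρ x =
    x ≡ orig (last ρ)
    ⊎ (Σ (Fin L) λ a → Σ (Fin n) λ u → (u ≡ stop ρ (inject₁ a) ⊎ u ≡ stop ρ (suc a)) × x ≡ attach u (via ρ a))
    ⊎ (Σ (Fin L) λ a → Σ (Fin L) λ b → Consecutive a b × MiddleOfOpposite (stop ρ (suc a)) (via ρ a) (via ρ b) x)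

  -- In the last disjunct a is the first hop; it is written via toℕ because Fin L may be empty.
  OnExpansionFrom : ∀ {L} → Route L → Fin m → Node → Set
  OnExpansionFrom {L} ρ e₀ x =
    OnExpansion ρ x ⊎ x ≡ attach (first ρ) e₀ ⊎ (Σ (Fin L) λ a → toℕ a ≡ 0 × MiddleOfOpposite (first ρ) e₀ (via ρ a) x)

  OnExpansionFrom-tail : ∀ {L} (ρ : Route (suc L)) {x} → OnExpansionFrom (tail ρ) (via ρ zero) x → OnExpansion ρ x
  OnExpansionFrom-tail ρ (inj₁ (inj₁ x≡)) = inj₁ x≡
  OnExpansionFrom-tail ρ (inj₁ (inj₂ (inj₁ (a , u , u≡ , x≡)))) = inj₂ (inj₁ (suc a , u , u≡ , x≡))
  OnExpansionFrom-tail ρ (inj₁ (inj₂ (inj₂ (a , b , ab , middle)))) = inj₂ (inj₂ (suc a , suc b , cong suc ab , middle))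
  OnExpansionFrom-tail ρ (inj₂ (inj₁ x≡)) = inj₂ (inj₁ (zero , first (tail ρ) , inj₂ refl , x≡))
  OnExpansionFrom-tail ρ (inj₂ (inj₂ (a , a≡0 , middle))) = inj₂ (inj₂ (zero , suc a , cong suc a≡0 , middle))

  expandFrom-∈ : ∀ {L} (ρ : Route L) e₀ e₀∈ ¬rep {x} → x ∈ W''.vertices (expandFrom ρ e₀ e₀∈ ¬rep) →
                OnExpansionFrom ρ e₀ x
  expandFrom-∈ {zero} ρ e₀ e₀∈ ¬rep x∈ with arrive-∈ (first ρ) e₀ ¬rep e₀∈ (Rep? _) (Tri? _) x∈
  ... | inj₁ x≡ = inj₂ (inj₁ x≡)
  ... | inj₂ x≡ = inj₁ (inj₁ x≡)
  expandFrom-∈ {suc L} ρ e₀ e₀∈ ¬rep x∈ with W''.∈-◅◅⁻ (throughFirst ρ e₀ e₀∈) (joins⇒adj'' (joined ρ zero)) _ x∈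
  ... | inj₂ x∈rest = inj₁ (OnExpansionFrom-tail ρ (expandFrom-∈ (tail ρ) (via ρ zero) (via₀∈ʳ ρ) ¬rep x∈rest))
  ... | inj₁ x∈through with through-∈ (first ρ) e₀ (via ρ zero) e₀∈ (via₀∈ˡ ρ) (Rep? _) (Tri? _) x∈through
  ...   | inj₁ x≡ = inj₂ (inj₁ x≡)
  ...   | inj₂ (inj₁ x≡) = inj₁ (inj₂ (inj₁ (zero , first ρ , inj₁ refl , x≡)))
  ...   | inj₂ (inj₂ middle) = inj₂ (inj₂ (zero , refl , middle))

  expand-∈ : ∀ {L} (ρ : Route L) ¬rep₀ ¬rep {x} → x ∈ W''.vertices (expand ρ ¬rep₀ ¬rep) →
            x ≡ orig (first ρ) ⊎ OnExpansion ρ x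
  expand-∈ {zero} ρ _ _ (here refl) = inj₁ refl
  expand-∈ {suc L} ρ ¬rep₀ ¬rep x∈ with W''.∈-◅◅⁻ (departFirst ρ ¬rep₀) (joins⇒adj'' (joined ρ zero)) _ x∈
  ... | inj₂ x∈rest = inj₂ (OnExpansionFrom-tail ρ (expandFrom-∈ (tail ρ) (via ρ zero) (via₀∈ʳ ρ) ¬rep x∈rest))
  ... | inj₁ x∈depart with depart-∈ (first ρ) (via ρ zero) ¬rep₀ (via₀∈ˡ ρ) (Rep? _) (Tri? _) x∈depart
  ...   | inj₁ x≡ = inj₁ x≡
  ...   | inj₂ x≡ = inj₂ (inj₂ (inj₁ (zero , first ρ , inj₁ refl , x≡)))

  simpleWalk⇒Path'' : ∀ {x y x' y'} (w : W''.Walk x' y') → W''.Simple w → x' ≡ x → y' ≡ y → Path'' G H x y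
  simpleWalk⇒Path'' w simple x'≡x y'≡y = record
    { len'' = W''.steps w ; vert'' = W''.vertexAt w
    ; start'' = trans (W''.vertexAt-zero w) x'≡x ; finish'' = trans (W''.vertexAt-last w) y'≡y
    ; adj'' = W''.stepAt w ; simple'' = W''.vertexAt-injective simple }

  module FromFlow (P : ∀ j → GPath G (hs H j) (ht H j))
                  (flow : ∀ j j' → j ≢ j' → (∀ a b → edge (P j) a ≢ edge (P j') b) × Uncrossed G (P j) (P j')) where

    edge-disjoint : ∀ {j j'} → j ≢ j' → ∀ a b → edge (P j) a ≢ edge (P j') b
    edge-disjoint {j} {j'} j≢j' = proj₁ (flow j j' j≢j')

    route : ∀ j → Route (len (P j))
    route j = record { stop = vert (P j) ; via = edge (P j) ; joined = joins (P j) }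

    ¬rep-first : ∀ j → ¬ Rep G H (first (route j))
    ¬rep-first j rep = end⇒¬Rep j (hs H j) (inj₁ refl) (subst (Rep G H) (start (P j)) rep)

    ¬rep-last : ∀ j → ¬ Rep G H (last (route j))
    ¬rep-last j rep = end⇒¬Rep j (ht H j) (inj₂ refl) (subst (Rep G H) (finish (P j)) rep)

    W : ∀ j → W''.Walk (orig (first (route j))) (orig (last (route j)))
    W j = expand (route j) (¬rep-first j) (¬rep-last j)

    P'' : ∀ j → Path'' G H (orig (hs H j)) (orig (ht H j))
    P'' j = simpleWalk⇒Path'' (W j) (expand-simple (route j) (¬rep-first j) (¬rep-last j) (simple (P j)))
                              (cong orig (start (P j))) (cong orig (finish (P j)))

    OnPath : Fin k → Fin n → Set
    OnPath j u = Σ (Fin (suc (len (P j)))) λ i → vert (P j) i ≡ u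

    Visit : Fin k → Node → Set
    Visit j x = (Σ (Fin n) λ v → x ≡ orig v × EndOf H j v)
              ⊎ (Σ (Fin (len (P j))) λ a → Σ (Fin n) λ u →
                   OnPath j u × edge (P j) a ∈ rot G u × x ≡ attach u (edge (P j) a))
              ⊎ (Σ (Fin (len (P j))) λ a → Σ (Fin (len (P j))) λ b → Consecutive a b ×
                   MiddleOfOpposite (vert (P j) (suc a)) (edge (P j) a) (edge (P j) b) x)

    visit : ∀ j {x} → x ∈ W''.vertices (W j) → Visit j x
    visit j x∈ with expand-∈ (route j) (¬rep-first j) (¬rep-last j) x∈
    ... | inj₁ x≡ = inj₁ (_ , x≡ , inj₁ (start (P j)))
    ... | inj₂ (inj₁ x≡) = inj₁ (_ , x≡ , inj₂ (finish (P j)))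
    ... | inj₂ (inj₂ (inj₁ (a , _ , inj₁ refl , x≡))) = inj₂ (inj₁ (a , _ , (inject₁ a , refl) , joins⇒∈rotˡ (joins (P j) a) , x≡))
    ... | inj₂ (inj₂ (inj₁ (a , _ , inj₂ refl , x≡))) = inj₂ (inj₁ (a , _ , (suc a , refl) , joins⇒∈rotʳ (joins (P j) a) , x≡))
    ... | inj₂ (inj₂ (inj₂ middle)) = inj₂ (inj₂ middle)

    end-on-path : ∀ j {v} → EndOf H j v → OnPath j v
    end-on-path j (inj₁ v≡s) = zero , trans (start (P j)) (sym v≡s)
    end-on-path j (inj₂ v≡t) = fromℕ _ , trans (finish (P j)) (sym v≡t)

    inner-of : ∀ j {v} → OnPath j v → ¬ EndOf H j v →
               Σ (Fin (len (P j))) λ a → Σ (Fin (len (P j))) λ b → Consecutive a b × vert (P j) (suc a) ≡ v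
    inner-of j (i , i≡v) ¬end = PathFacts.inner-stop G (P j) i i≡v (¬end ∘ inj₁) (¬end ∘ inj₂)

    end-meets-inner : ∀ {j j'} → j ≢ j' → ∀ {v} → EndOf H j v → OnPath j' v → ¬ EndOf H j' v → Tri G H v
    end-meets-inner {j} {j'} j≢j' {v} end on' ¬end' with inner-of j' on' ¬end'
    ... | c , d , cd , c≡v with PathFacts.inner-edges G (P j') cd c≡v | PathFacts.end-edge G (P j) (proj₁ matching j) end
    ...   | c∈ , d∈ , c≢d | a , a∈ =
      three-incident⇒Tri (end⇒degH≡1 j v end) a∈ c∈ d∈ (edge-disjoint j≢j' a c) (edge-disjoint j≢j' a d) c≢d

    inner-meets-inner : ∀ {j j'} → j ≢ j' → ∀ {v} → OnPath j v → OnPath j' v → ¬ EndOf H j v → ¬ EndOf H j' v → Rep G H v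
    inner-meets-inner {j} {j'} j≢j' on on' ¬end ¬end' with inner-of j on ¬end | inner-of j' on' ¬end'
    ... | a , b , ab , a≡v | c , d , cd , c≡v with PathFacts.inner-edges G (P j) ab a≡v | PathFacts.inner-edges G (P j') cd c≡v
    ...   | a∈ , b∈ , a≢b | c∈ , d∈ , c≢d =
      four-incident⇒Rep a∈ b∈ c∈ d∈ a≢b (edge-disjoint j≢j' a c) (edge-disjoint j≢j' a d)
                        (edge-disjoint j≢j' b c) (edge-disjoint j≢j' b d) c≢d

    EndOrPlain : Fin k → Fin n → Set
    EndOrPlain j v = EndOf H j v ⊎ (¬ Rep G H v × ¬ Tri G H v)

    no-shared-plain-stop : ∀ {j j'} → j ≢ j' → ∀ {v} → OnPath j v → OnPath j' v → EndOrPlain j v → EndOrPlain j' v → ⊥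
    no-shared-plain-stop {j} {j'} j≢j' {v} on on' kind kind' with endOf? H j v | endOf? H j' v | kind | kind'
    ... | yes end | yes end' | _ | _ = j≢j' (proj₂ matching j j' v end end')
    ... | yes end | no ¬end' | _ | inj₁ end' = ¬end' end'
    ... | yes end | no ¬end' | _ | inj₂ (_ , ¬tri) = ¬tri (end-meets-inner j≢j' end on' ¬end')
    ... | no ¬end | yes end' | inj₁ end | _ = ¬end end
    ... | no ¬end | yes end' | inj₂ (_ , ¬tri) | _ = ¬tri (end-meets-inner (j≢j' ∘ sym) end' on ¬end)
    ... | no ¬end | no ¬end' | inj₁ end | _ = ¬end end
    ... | no ¬end | no ¬end' | inj₂ (¬rep , _) | _ = ¬rep (inner-meets-inner j≢j' on on' ¬end ¬end')

    private
      module _ {j j'} (j≢j' : j ≢ j') {a b c d} (ab : Consecutive a b) (cd : Consecutive c d)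
               (w≡ : vert (P j) (suc a) ≡ vert (P j') (suc c))
               {a₀ a₁ a₂ a₃} (rot≡ : rot G (vert (P j) (suc a)) ≡ a₀ ∷ a₁ ∷ a₂ ∷ a₃ ∷ []) where
        open Quadruple a₀ a₁ a₂ a₃

        w : Fin n
        w = vert (P j) (suc a)

        at-position : ∀ {e} → e ∈ rot G w → at (position w e) ≡ e
        at-position {e} e∈ =
          just-injective (trans (sym (trans (cong (λ r → nth r (toℕ (position w e))) rot≡) (nth-lookup quad (position w e)))) (position-nth e∈))

        opposite-pass-crosses : position w (edge (P j) b) ≡ suc₄ (suc₄ (position w (edge (P j) a))) →
                                Crosses quad (edge (P j) a) (edge (P j) b) (edge (P j') c) (edge (P j') d)
        opposite-pass-crosses opp =
          crosses-opposite p r r' (at-position a∈) (trans (cong at (sym opp)) (at-position b∈)) (at-position c∈) (at-position d∈)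
            (λ r≡p → edge-disjoint j≢j' a c (sym (position-injective c∈ a∈ r≡p)))
            (λ r≡opp → edge-disjoint j≢j' b c (sym (position-injective c∈ b∈ (trans r≡opp (sym opp)))))
            (λ r'≡p → edge-disjoint j≢j' a d (sym (position-injective d∈ a∈ r'≡p)))
            (λ r'≡opp → edge-disjoint j≢j' b d (sym (position-injective d∈ b∈ (trans r'≡opp (sym opp)))))
            (λ r≡r' → c≢d (position-injective c∈ d∈ r≡r'))
          where
          ab-edges = PathFacts.inner-edges G (P j) ab refl
          cd-edges = PathFacts.inner-edges G (P j') cd (sym w≡)
          a∈ = proj₁ ab-edges
          b∈ = proj₁ (proj₂ ab-edges)
          c∈ = proj₁ cd-edges
          d∈ = proj₁ (proj₂ cd-edges)
          c≢d = proj₂ (proj₂ cd-edges)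
          p = position w (edge (P j) a)
          r = position w (edge (P j') c)
          r' = position w (edge (P j') d)

    no-opposite-pass : ∀ {j j'} → j ≢ j' → ∀ {a b c d} → Consecutive a b → Consecutive c d →
                       Rep G H (vert (P j) (suc a)) → vert (P j) (suc a) ≡ vert (P j') (suc c) →
                       position (vert (P j) (suc a)) (edge (P j) b) ≡ suc₄ (suc₄ (position (vert (P j) (suc a)) (edge (P j) a))) → ⊥
    no-opposite-pass {j} {j'} j≢j' {a} {b} {c} {d} ab cd rep w≡ opp with length≡4 (rot G (vert (P j) (suc a))) (proj₂ rep)
    ... | _ , _ , _ , _ , rot≡ =
      proj₂ (flow j j' j≢j') a b c d ab cd w≡
        (subst (λ r → Crosses r (edge (P j) a) (edge (P j) b) (edge (P j') c) (edge (P j') d)) (sym rot≡)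
          (opposite-pass-crosses j≢j' ab cd w≡ rot≡ opp))

    attach-not-middle : ∀ {j j'} → j ≢ j' → ∀ {u e} → OnPath j u → ∀ {c d} → Consecutive c d →
                        ¬ MiddleOfOpposite (vert (P j') (suc c)) (edge (P j') c) (edge (P j') d) (attach u e)
    attach-not-middle {j} j≢j' on cd (rep , x≡ , opp) with attach≡cyc x≡
    ... | refl , _ , _ with inner-of j on (λ end → end⇒¬Rep j _ end rep)
    ...   | a , b , ab , a≡u = no-opposite-pass (j≢j' ∘ sym) cd ab rep (sym a≡u) opp

    visits-disjoint : ∀ {j j'} → j ≢ j' → ∀ {x} → Visit j x → Visit j' x → ⊥
    visits-disjoint {j} {j'} j≢j' (inj₁ (v , refl , end)) (inj₁ (_ , refl , end')) = j≢j' (proj₂ matching j j' v end end')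
    visits-disjoint j≢j' (inj₁ (_ , refl , end)) (inj₂ (inj₁ (_ , _ , on' , _ , x≡))) with attach≡orig (sym x≡)
    ... | refl , ¬rep , ¬tri = no-shared-plain-stop j≢j' (end-on-path _ end) on' (inj₁ end) (inj₂ (¬rep , ¬tri))
    visits-disjoint j≢j' (inj₁ (_ , refl , _)) (inj₂ (inj₂ (_ , _ , _ , _ , () , _)))
    visits-disjoint j≢j' (inj₂ (inj₁ (_ , _ , on , _ , x≡))) (inj₁ (_ , refl , end')) with attach≡orig (sym x≡)
    ... | refl , ¬rep , ¬tri = no-shared-plain-stop j≢j' on (end-on-path _ end') (inj₂ (¬rep , ¬tri)) (inj₁ end')
    visits-disjoint j≢j' (inj₂ (inj₂ (_ , _ , _ , _ , () , _))) (inj₁ (_ , refl , _))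
    visits-disjoint {j} j≢j' (inj₂ (inj₁ (a , u , on , a∈ , refl))) (inj₂ (inj₁ (a' , _ , on' , a'∈ , x≡)))
      with attach-cases u (edge (P j) a)
    ... | inj₁ (_ , x≡cyc) with attach≡cyc (trans (sym x≡) x≡cyc)
    ...   | refl , _ , same-position = edge-disjoint j≢j' a a' (sym (position-injective a'∈ a∈ same-position))
    visits-disjoint j≢j' (inj₂ (inj₁ (a , _ , _ , _ , refl))) (inj₂ (inj₁ (a' , _ , _ , _ , x≡))) | inj₂ (inj₁ x≡sub) =
      edge-disjoint j≢j' a a' (sym (attach≡sub (trans (sym x≡) x≡sub)))
    visits-disjoint j≢j' (inj₂ (inj₁ (_ , _ , on , _ , refl))) (inj₂ (inj₁ (_ , _ , on' , _ , x≡))) | inj₂ (inj₂ (¬rep , ¬tri , x≡orig))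
      with attach≡orig (trans (sym x≡) x≡orig)
    ... | refl , _ , _ = no-shared-plain-stop j≢j' on on' (inj₂ (¬rep , ¬tri)) (inj₂ (¬rep , ¬tri))
    visits-disjoint j≢j' (inj₂ (inj₁ (_ , _ , on , _ , refl))) (inj₂ (inj₂ (_ , _ , cd , middle))) =
      attach-not-middle j≢j' on cd middle
    visits-disjoint j≢j' (inj₂ (inj₂ (_ , _ , cd , middle))) (inj₂ (inj₁ (_ , _ , on , _ , x≡))) =
      attach-not-middle (j≢j' ∘ sym) on cd (subst (MiddleOfOpposite _ _ _) x≡ middle)
    visits-disjoint j≢j' (inj₂ (inj₂ (_ , _ , ab , rep , x≡ , opp))) (inj₂ (inj₂ (_ , _ , cd , _ , x≡' , _))) =
      no-opposite-pass j≢j' ab cd rep (cong vertexOf (trans (sym x≡) x≡')) opp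

    disjoint : ∀ j j' → j ≢ j' → ∀ a b → vert'' (P'' j) a ≢ vert'' (P'' j') b
    disjoint j j' j≢j' a b same-node =
      visits-disjoint j≢j' (visit j (W''.vertexAt-∈ (W j) a))
                           (visit j' (subst (_∈ W''.vertices (W j')) (sym same-node) (W''.vertexAt-∈ (W j') b)))

  uncrossedFlow⇒disjointPaths : UncrossedFlow G H → DisjointPaths'' G H
  uncrossedFlow⇒disjointPaths (P , flow) = P'' , disjoint
    where open FromFlow P flow

lemma4 : ∀ {n m k} (G : EmbGraph n m) → Planar G → MaxDeg4 G →
         (H : Demand n k) → IsMatching H →
         (∀ v → degH H v ≡ 1 → deg G v ≤ 3) →
         UncrossedFlow G H ⇔ DisjointPaths'' G H
lemma4 G _ maxDeg4 H matching ends-small = mk⇔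
  (Expansion.uncrossedFlow⇒disjointPaths G maxDeg4 H matching ends-small)
  (Contraction.disjointPaths⇒uncrossedFlow G maxDeg4 H matching ends-small)
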